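{- Let $n\ge2$ and $\epsilon_i\in\{ -1,1\}$ for $2\le i\le n$, and define $$\alpha(\epsilon_2,\ldots,\epsilon_n):=\frac12+\frac14+\sum_{2\le i\le n}\epsilon_i\,2^{ -2^i}.$$ Then the continued fraction expansion of $\alpha(\epsilon_2,\ldots,\epsilon_n)$ is $[0,1,(2R_{1,\epsilon_2,\ldots,\epsilon_n})']$, where $2R$ denotes the sequence $R$ with every term doubled and the prime indicates that the last term is increased by $1$. Consequently, for every infinite sequence $(\epsilon_i)_{i\ge2}$ over $\{ -1,1\}$, the number $\alpha(\epsilon_2,\epsilon_3,\ldots):=\frac12+\frac14+\sum_{i\ge2}\epsilon_i2^{ -2^i}$ has the infinite continued fraction expansion $[0,1,2R_{1,\epsilon_2,\epsilon_3,\ldots}]$.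
   Context: For a finite sequence $\mathbf f$ over $\{ -1,1\}$ define $P_\epsilon=\epsilon$ (empty) and $P_{\mathbf f a}=P_{\mathbf f}\ a\ (-P_{\mathbf f}^R)$ for $a\in\{ -1,1\}$, where $-x$ negates every entry and $x^R$ is reversal. For an infinite $\mathbf f=f_0f_1\cdots$, $P_{\mathbf f}$ is the unique infinite sequence having every $P_{f_0\cdots f_n}$ as a prefix. A run is a maximal block of consecutive identical entries; $R_{\mathbf f}$ is the sequence of lengths of the runs of $P_{\mathbf f}$ from left to right. Here $R_{1,\epsilon_2,\ldots,\epsilon_n}$ is $R_{\mathbf f}$ for the unfolding instructions $\mathbf f=(1,\epsilon_2,\ldots,\epsilon_n)$. $[a_0,a_1,a_2,\ldots]$ denotes the (simple) continued fraction $a_0+1/(a_1+1/(a_2+\cdots))$. -}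

module Defs where

open import Data.Nat as ℕ using (ℕ; zero; suc; _∸_; _^_)
open import Data.Integer using (+_)
open import Data.Rational as ℚ using (ℚ; 0ℚ; 1ℚ; ½; _/_)
open import Data.List using (List; []; _∷_; _++_; map; reverse; foldl; foldr; upTo)
open import Data.Sign using (Sign; opposite) renaming (+ to plus; - to minus)
open import Data.Sign.Properties using (_≟_)
open import Data.Product using (_×_; _,_)
open import Relation.Nullary using (yes; no)
open import Relation.Binary.PropositionalEquality using (_≡_; _≢_)

-- Paperfolding sequences over {-1,1}, represented by Sign (plus = 1, minus = -1)

unfoldStep : List Sign → Sign → List Sign
unfoldStep P a = P ++ (a ∷ map opposite (reverse P))

unfold : List Sign → List Sign
unfold = foldl unfoldStep []

runsFrom : Sign → ℕ → List Sign → List ℕ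
runsFrom c k [] = k ∷ []
runsFrom c k (y ∷ ys) with y ≟ c
... | yes _ = runsFrom c (suc k) ys
... | no _  = k ∷ runsFrom y 1 ys

runs : List Sign → List ℕ
runs [] = []
runs (x ∷ xs) = runsFrom x 1 xs

R : List Sign → List ℕ
R f = runs (unfold f)

prefix : {A : Set} → (ℕ → A) → ℕ → List A
prefix s zero = []
prefix s (suc m) = prefix s m ++ (s m ∷ [])

nth : {A : Set} → A → List A → ℕ → A
nth d [] j = d
nth d (x ∷ xs) zero = x
nth d (x ∷ xs) (suc j) = nth d xs j

-- P_f for infinite f: entry j is entry j of P_{f_0..f_j}
-- (which has length 2^(j+1) - 1 > j, and every P_{f_0..f_n} is a prefix of P_f)
Pinf : (ℕ → Sign) → ℕ → Sign
Pinf f j = nth plus (unfold (prefix f (suc j))) j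

psum : (ℕ → ℕ) → ℕ → ℕ
psum a zero = 0
psum a (suc k) = psum a k ℕ.+ a k

IsRunLengths : (ℕ → Sign) → (ℕ → ℕ) → Set
IsRunLengths s a =
  (∀ k → 1 ℕ.≤ a k) ×
  (∀ k j → j ℕ.< a k → s (psum a k ℕ.+ j) ≡ s (psum a k)) ×
  (∀ k → s (psum a (suc k)) ≢ s (psum a k))

cfPair : List ℕ → ℕ × ℕ
cfPair [] = (1 , 0)
cfPair (a ∷ r) with cfPair r
... | (p , q) = (a ℕ.* p ℕ.+ q , p)

frac : ℕ → ℕ → ℚ
frac p zero = 0ℚ
frac p (suc q) = (+ p) / suc q

cfValue : List ℕ → ℚ
cfValue l with cfPair l
... | (p , q) = frac p q

double : List ℕ → List ℕ
double = map (λ x → 2 ℕ.* x)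

incLast : List ℕ → List ℕ
incLast [] = []
incLast (x ∷ []) = suc x ∷ []
incLast (x ∷ y ∷ ys) = x ∷ incLast (y ∷ ys)

signℚ : Sign → ℚ
signℚ plus = 1ℚ
signℚ minus = ℚ.- 1ℚ

pow2inv : ℕ → ℚ
pow2inv zero = 1ℚ
pow2inv (suc m) = ½ ℚ.* pow2inv m

-- the list [2, 3, ..., n]
range2 : ℕ → List ℕ
range2 n = map (λ k → k ℕ.+ 2) (upTo (n ∸ 1))

α : (ℕ → Sign) → ℕ → ℚ
α ε n = ½ ℚ.+ (+ 1 / 4) ℚ.+ foldr ℚ._+_ 0ℚ (map (λ i → signℚ (ε i) ℚ.* pow2inv (2 ^ i)) (range2 n))

finInstr : (ℕ → Sign) → ℕ → List Sign
finInstr ε n = plus ∷ map ε (range2 n)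

infInstr : (ℕ → Sign) → ℕ → Sign
infInstr ε zero = plus
infInstr ε (suc i) = ε (suc (suc i))

cfSeq : (ℕ → ℕ) → ℕ → ℕ
cfSeq a zero = 0
cfSeq a (suc zero) = 1
cfSeq a (suc (suc k)) = 2 ℕ.* a k

-- P_{1, ε₂, …, ε_n} is a sequence of blocks 1^x (−1)^y, and an unfolding step acts on the block list
-- by appending a mirrored copy with one run lengthened. On the continuant matrix T of the doubled run
-- lengths 2R this step is T ↦ T E Tᵀ with E = [[1, 2], [0, 1]] or [[1, 0], [2, 1]]. Hence det T = 1
-- throughout, and the value p / q of [0, 1, (2R)′], read off from T, moves to (p q ± 1) / q² = p / q ± 1 / q².
-- As q = 2^(2^n), this adds exactly the next term ε_{n+1} 2^(−2^(n+1)) of α.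
-- For infinite ε, the run lengths of the prefixes change only in their last entry, so they stabilise to
-- the run lengths of P_f; a convergent of the limit and α(ε₂, …, ε_N) are then continued fractions with
-- a long common prefix, hence close.

module Submission where

open import Defs
open import Data.Nat as ℕ using (ℕ; zero; suc; _+_; _*_; _∸_; _^_; _≤_; _<_; s≤s; z≤n)
open import Data.Nat.Properties
  using (≤-refl; ≤-trans; ≤-reflexive; ≤-total; <-trans; ≤-<-trans; <⇒≤; n<1+n; n≤1+n; m≤m+n; m≤n+m; m<n+m; m≤m*n; m≤n*m;
         +-comm; +-assoc; +-suc; +-identityʳ; +-cancelʳ-≡; +-mono-≤; +-monoˡ-≤; +-monoʳ-≤; ∸-monoˡ-≤; m+n∸m≡n; m∸n+n≡m;
         *-comm; *-suc; *-zeroʳ; *-identityˡ; *-identityʳ; *-mono-≤; *-monoˡ-≤; *-monoʳ-≤; m^n>0; ^-distribˡ-+-*;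
         m≤n⇒m<n∨m≡n; module ≤-Reasoning)
open import Data.Nat.Tactic.RingSolver using (solve-∀)
open import Data.Nat.Coprimality using (Coprime)
open import Data.Integer as ℤ using ()
import Data.Integer.Properties as ℤ
open import Data.Rational as ℚ using (ℚ; mkℚ; 0ℚ; 1ℚ; ½; _-_; ∣_∣; toℚᵘ)
import Data.Rational.Properties as ℚ
open import Data.Rational.Unnormalised as ℚᵘ using (mkℚᵘ; *≡*) renaming (_≃_ to _≃ᵘ_)
import Data.Rational.Unnormalised.Properties as ℚᵘ
open import Data.List using (List; []; _∷_; _++_; _∷ʳ_; [_]; map; reverse; replicate; foldl; foldr; upTo; length)
open import Data.List.Properties
  using (++-assoc; ++-identityʳ; map-++; map-replicate; reverse-++; reverse-map; unfold-reverse; upTo-∷ʳ; foldl-++;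
         length-++; length-map; length-reverse)
open import Data.List.Relation.Unary.All using (All; []; _∷_)
open import Data.List.Relation.Unary.All.Properties using (++⁺; ++⁻ʳ; ∷ʳ⁺)
open import Data.Product using (_×_; _,_; proj₁; proj₂; Σ; ∃; ∃₂; swap)
open import Data.Sum using (inj₁; inj₂)
open import Data.Sign using (Sign; opposite) renaming (+ to plus; - to minus; _*_ to _*ₛ_)
open import Relation.Binary.PropositionalEquality hiding ([_])

-- Continuant matrices

record M2 : Set where
  constructor m2
  field
    ma mb mc md : ℕ
open M2

m2-cong : ∀ {a b c d a′ b′ c′ d′} → a ≡ a′ → b ≡ b′ → c ≡ c′ → d ≡ d′ → m2 a b c d ≡ m2 a′ b′ c′ d′
m2-cong refl refl refl refl = refl

mul : M2 → M2 → M2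
mul (m2 a b c d) (m2 a′ b′ c′ d′) =
  m2 (a * a′ + b * c′) (a * b′ + b * d′) (c * a′ + d * c′) (c * b′ + d * d′)

transpose : M2 → M2
transpose (m2 a b c d) = m2 a c b d

I₂ : M2
I₂ = m2 1 0 0 1

mul-assoc : ∀ X Y Z → mul (mul X Y) Z ≡ mul X (mul Y Z)
mul-assoc (m2 a b c d) (m2 a′ b′ c′ d′) (m2 a″ b″ c″ d″) =
  m2-cong (entry a b a″ c″) (entry a b b″ d″) (entry c d a″ c″) (entry c d b″ d″)
  where
  associativity : ∀ x y a b c d z w → (x * a + y * c) * z + (x * b + y * d) * w ≡ x * (a * z + b * w) + y * (c * z + d * w)
  associativity = solve-∀
  entry : ∀ x y z w → (x * a′ + y * c′) * z + (x * b′ + y * d′) * w ≡ x * (a′ * z + b′ * w) + y * (c′ * z + d′ * w)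
  entry x y = associativity x y a′ b′ c′ d′

mul-identityˡ : ∀ X → mul I₂ X ≡ X
mul-identityˡ (m2 a b c d) = m2-cong (row a c) (row b d) (row′ a c) (row′ b d)
  where
  row : ∀ x y → 1 * x + 0 * y ≡ x
  row = solve-∀
  row′ : ∀ x y → 0 * x + 1 * y ≡ y
  row′ = solve-∀

mul-identityʳ : ∀ X → mul X I₂ ≡ X
mul-identityʳ (m2 a b c d) = m2-cong (col a b) (col′ a b) (col c d) (col′ c d)
  where
  col : ∀ x y → x * 1 + y * 0 ≡ x
  col = solve-∀
  col′ : ∀ x y → x * 0 + y * 1 ≡ y
  col′ = solve-∀

transpose-mul : ∀ X Y → transpose (mul X Y) ≡ mul (transpose Y) (transpose X)
transpose-mul (m2 a b c d) (m2 a′ b′ c′ d′) =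
  m2-cong (commute a b a′ c′) (commute c d a′ c′) (commute a b b′ d′) (commute c d b′ d′)
  where
  commute : ∀ x y z w → x * z + y * w ≡ z * x + w * y
  commute = solve-∀

quotientMatrix : ℕ → M2
quotientMatrix x = m2 x 1 1 0

-- cfMatrix [a₀, …, aₙ] = [[p, p′], [q, q′]] with p / q and p′ / q′ the last two convergents.
cfMatrix : List ℕ → M2
cfMatrix [] = I₂
cfMatrix (x ∷ l) = mul (quotientMatrix x) (cfMatrix l)

cfMatrix-++ : ∀ l l′ → cfMatrix (l ++ l′) ≡ mul (cfMatrix l) (cfMatrix l′)
cfMatrix-++ [] l′ = sym (mul-identityˡ _)
cfMatrix-++ (x ∷ l) l′ =
  trans (cong (mul (quotientMatrix x)) (cfMatrix-++ l l′)) (sym (mul-assoc (quotientMatrix x) _ _))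

cfMatrix-reverse : ∀ l → cfMatrix (reverse l) ≡ transpose (cfMatrix l)
cfMatrix-reverse [] = refl
cfMatrix-reverse (x ∷ l) = begin
  cfMatrix (reverse (x ∷ l))                           ≡⟨ cong cfMatrix (unfold-reverse x l) ⟩
  cfMatrix (reverse l ++ [ x ])                        ≡⟨ cfMatrix-++ (reverse l) [ x ] ⟩
  mul (cfMatrix (reverse l)) (mul (quotientMatrix x) I₂) ≡⟨ cong₂ mul (cfMatrix-reverse l) (mul-identityʳ _) ⟩
  mul (transpose (cfMatrix l)) (quotientMatrix x)      ≡⟨ sym (transpose-mul (quotientMatrix x) (cfMatrix l)) ⟩
  transpose (cfMatrix (x ∷ l))                         ∎
  where open ≡-Reasoning

cfMatrix-incLast : ∀ x xs → cfMatrix (incLast (x ∷ xs)) ≡ mul (cfMatrix (x ∷ xs)) (m2 1 0 1 1)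
cfMatrix-incLast x [] = begin
  mul (quotientMatrix (suc x)) I₂                   ≡⟨ mul-identityʳ (quotientMatrix (suc x)) ⟩
  quotientMatrix (suc x)                            ≡⟨ m2-cong (suc-entry x) (one x) refl refl ⟩
  mul (quotientMatrix x) (m2 1 0 1 1)               ≡⟨ cong (λ M → mul M (m2 1 0 1 1)) (mul-identityʳ (quotientMatrix x)) ⟨
  mul (mul (quotientMatrix x) I₂) (m2 1 0 1 1)      ∎
  where
  open ≡-Reasoning
  suc-entry : ∀ x → suc x ≡ x * 1 + 1 * 1
  suc-entry = solve-∀
  one : ∀ x → 1 ≡ x * 0 + 1 * 1
  one = solve-∀
cfMatrix-incLast x (y ∷ xs) =
  trans (cong (mul (quotientMatrix x)) (cfMatrix-incLast y xs)) (sym (mul-assoc (quotientMatrix x) (cfMatrix (y ∷ xs)) (m2 1 0 1 1)))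

cfPair≡cfMatrix : ∀ l → cfPair l ≡ (ma (cfMatrix l) , mc (cfMatrix l))
cfPair≡cfMatrix [] = refl
cfPair≡cfMatrix (x ∷ l) rewrite cfPair≡cfMatrix l =
  cong₂ _,_ (numerator x (ma (cfMatrix l)) (mc (cfMatrix l))) (denominator (ma (cfMatrix l)) (mc (cfMatrix l)))
  where
  numerator : ∀ x p q → x * p + q ≡ x * p + 1 * q
  numerator = solve-∀
  denominator : ∀ p q → p ≡ 1 * p + 0 * q
  denominator = solve-∀

cfValue≡frac : ∀ l → cfValue l ≡ frac (ma (cfMatrix l)) (mc (cfMatrix l))
cfValue≡frac l rewrite cfPair≡cfMatrix l = refl

cfValue-++ : ∀ C U → cfValue (C ++ U) ≡ frac (ma (mul (cfMatrix C) (cfMatrix U))) (mc (mul (cfMatrix C) (cfMatrix U)))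
cfValue-++ C U = trans (cfValue≡frac (C ++ U)) (cong (λ M → frac (ma M) (mc M)) (cfMatrix-++ C U))

cfValue-0∷1∷ : ∀ X → cfValue (0 ∷ 1 ∷ X) ≡ frac (ma (cfMatrix X)) (ma (cfMatrix X) + mc (cfMatrix X))
cfValue-0∷1∷ X rewrite cfPair≡cfMatrix X = cong (λ p → frac (ma (cfMatrix X)) (p + mc (cfMatrix X))) (*-identityˡ (ma (cfMatrix X)))

-- Unimodular matrices

-- x − y = s 1, stated without subtraction.
UnitGap : Sign → ℕ → ℕ → Set
UnitGap plus x y = x ≡ y + 1
UnitGap minus x y = y ≡ x + 1

HasDet : Sign → M2 → Set
HasDet s (m2 a b c d) = UnitGap s (a * d) (b * c)

UnitGap-shift : ∀ s {P Q x y} → P + y ≡ Q + x → UnitGap s x y → UnitGap s P Q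
UnitGap-shift plus {P} {Q} {_} {y} e refl = +-cancelʳ-≡ y P (Q + 1) (trans e (shift Q y))
  where
  shift : ∀ Q y → Q + (y + 1) ≡ Q + 1 + y
  shift = solve-∀
UnitGap-shift minus {P} {Q} {x} {_} e refl = +-cancelʳ-≡ x Q (P + 1) (trans (sym e) (shift P x))
  where
  shift : ∀ P x → P + (x + 1) ≡ P + 1 + x
  shift = solve-∀

-- L − R = (x − y)(a − b), read off when x − y = 1.
cross-cancel : ∀ {L R x y a b} → L + x * b + y * a ≡ R + x * a + y * b → x ≡ y + 1 → L + b ≡ R + a
cross-cancel {L} {R} {_} {y} {a} {b} e refl = +-cancelʳ-≡ (y * a + y * b) (L + b) (R + a) (begin
  L + b + (y * a + y * b)      ≡⟨ regroup L y a b ⟨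
  L + (y + 1) * b + y * a      ≡⟨ e ⟩
  R + (y + 1) * a + y * b      ≡⟨ regroup R y b a ⟩
  R + a + (y * b + y * a)      ≡⟨ cong (R + a +_) (+-comm (y * b) (y * a)) ⟩
  R + a + (y * a + y * b)      ∎)
  where
  open ≡-Reasoning
  regroup : ∀ L y a b → L + (y + 1) * b + y * a ≡ L + b + (y * a + y * b)
  regroup = solve-∀

UnitGap-* : ∀ s t {L R x y x′ y′} → L + x * y′ + y * x′ ≡ R + x * x′ + y * y′ →
            UnitGap s x y → UnitGap t x′ y′ → UnitGap (s *ₛ t) L R
UnitGap-* plus t e g g′ = UnitGap-shift t (cross-cancel e g) g′
UnitGap-* minus t {L} {R} {x} {y} {x′} {y′} e g g′ = flip t (UnitGap-shift t (sym (cross-cancel swapped g)) g′)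
  where
  swap-last : ∀ a b c → a + b + c ≡ a + c + b
  swap-last = solve-∀
  swapped : L + y * x′ + x * y′ ≡ R + y * y′ + x * x′
  swapped = trans (swap-last L (y * x′) (x * y′)) (trans e (swap-last R (x * x′) (y * y′)))
  flip : ∀ t → UnitGap t R L → UnitGap (opposite t) L R
  flip plus gap = gap
  flip minus gap = gap

HasDet-mul : ∀ {s t} X Y → HasDet s X → HasDet t Y → HasDet (s *ₛ t) (mul X Y)
HasDet-mul {s} {t} (m2 a b c d) (m2 a′ b′ c′ d′) =
  UnitGap-* s t (cauchy-binet a b c d a′ b′ c′ d′)
  where
  cauchy-binet : ∀ a b c d a′ b′ c′ d′ →
    (a * a′ + b * c′) * (c * b′ + d * d′) + a * d * (b′ * c′) + b * c * (a′ * d′) ≡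
    (a * b′ + b * d′) * (c * a′ + d * c′) + a * d * (a′ * d′) + b * c * (b′ * c′)
  cauchy-binet = solve-∀

HasDet-transpose : ∀ s X → HasDet s X → HasDet s (transpose X)
HasDet-transpose s (m2 a b c d) = subst (UnitGap s (a * d)) (*-comm b c)

cfMatrix-unimodular : ∀ l → ∃ λ σ → HasDet σ (cfMatrix l)
cfMatrix-unimodular [] = plus , refl
cfMatrix-unimodular (x ∷ l) with cfMatrix-unimodular l
... | σ , det = _ , HasDet-mul {minus} {σ} (quotientMatrix x) (cfMatrix l) (cong (_+ 1) (sym (*-zeroʳ x))) det

-- Fractions of natural numbers

toℚᵘ-frac : ∀ a m → toℚᵘ (frac a (suc m)) ≃ᵘ mkℚᵘ (ℤ.+ a) m
toℚᵘ-frac a m = ℚ.toℚᵘ-fromℚᵘ (mkℚᵘ (ℤ.+ a) m)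

frac-cong : ∀ a m b n → a * suc n ≡ b * suc m → frac a (suc m) ≡ frac b (suc n)
frac-cong a m b n e = ℚ.toℚᵘ-injective (ℚᵘ.≃-trans (toℚᵘ-frac a m) (ℚᵘ.≃-trans
  (*≡* (trans (sym (ℤ.pos-* a (suc n))) (trans (cong ℤ.+_ e) (ℤ.pos-* b (suc m)))))
  (ℚᵘ.≃-sym (toℚᵘ-frac b n))))

frac-+ : ∀ a m b n → frac a (suc m) ℚ.+ frac b (suc n) ≡ frac (a * suc n + b * suc m) (suc m * suc n)
frac-+ a m b n = ℚ.toℚᵘ-injective (ℚᵘ.≃-trans (ℚ.toℚᵘ-homo-+ (frac a (suc m)) (frac b (suc n)))
  (ℚᵘ.≃-trans (ℚᵘ.+-cong (toℚᵘ-frac a m) (toℚᵘ-frac b n))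
  (ℚᵘ.≃-trans (ℚᵘ.≃-reflexive (cong (λ z → mkℚᵘ z (n + m * suc n)) numerator))
  (ℚᵘ.≃-sym (toℚᵘ-frac _ _)))))
  where
  numerator : ℤ.+ a ℤ.* ℤ.+ suc n ℤ.+ ℤ.+ b ℤ.* ℤ.+ suc m ≡ ℤ.+ (a * suc n + b * suc m)
  numerator = trans (cong₂ ℤ._+_ (sym (ℤ.pos-* a (suc n))) (sym (ℤ.pos-* b (suc m))))
                    (sym (ℤ.pos-+ (a * suc n) _))

frac-* : ∀ a m b n → frac a (suc m) ℚ.* frac b (suc n) ≡ frac (a * b) (suc m * suc n)
frac-* a m b n = ℚ.toℚᵘ-injective (ℚᵘ.≃-trans (ℚ.toℚᵘ-homo-* (frac a (suc m)) (frac b (suc n)))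
  (ℚᵘ.≃-trans (ℚᵘ.*-cong (toℚᵘ-frac a m) (toℚᵘ-frac b n))
  (ℚᵘ.≃-trans (ℚᵘ.≃-reflexive (cong (λ z → mkℚᵘ z (n + m * suc n)) (sym (ℤ.pos-* a b))))
  (ℚᵘ.≃-sym (toℚᵘ-frac _ _)))))

2^n≡1+ : ∀ n → Σ ℕ λ r → 2 ^ n ≡ suc r
2^n≡1+ n with 2 ^ n | m^n>0 2 n
... | suc r | _ = r , refl

pow2inv≡frac : ∀ m → pow2inv m ≡ frac 1 (2 ^ m)
pow2inv≡frac zero = refl
pow2inv≡frac (suc m) with 2^n≡1+ m
... | r , eq = begin
  ½ ℚ.* pow2inv m             ≡⟨ cong (½ ℚ.*_) (trans (pow2inv≡frac m) (cong (frac 1) eq)) ⟩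
  frac 1 2 ℚ.* frac 1 (suc r) ≡⟨ frac-* 1 1 1 r ⟩
  frac 1 (2 * suc r)          ≡⟨ cong (λ z → frac 1 (2 * z)) (sym eq) ⟩
  frac 1 (2 ^ suc m)          ∎
  where open ≡-Reasoning

frac-+-unit : ∀ s p Q P → UnitGap s P (p * suc Q) →
              frac P (suc Q * suc Q) ≡ frac p (suc Q) ℚ.+ signℚ s ℚ.* frac 1 (suc Q * suc Q)
frac-+-unit plus p Q P gap = begin
  frac P Q²                                 ≡⟨ frac-cong P m₂ (p * Q² + 1 * suc Q) (m₂ + Q * suc m₂) (cross p (suc Q) P gap) ⟩
  frac (p * Q² + 1 * suc Q) (suc Q * Q²)    ≡⟨ frac-+ p Q 1 m₂ ⟨
  frac p (suc Q) ℚ.+ frac 1 Q²              ≡⟨ cong (frac p (suc Q) ℚ.+_) (ℚ.*-identityˡ (frac 1 Q²)) ⟨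
  frac p (suc Q) ℚ.+ 1ℚ ℚ.* frac 1 Q²       ∎
  where
  open ≡-Reasoning
  m₂ : ℕ
  m₂ = Q + Q * suc Q
  Q² : ℕ
  Q² = suc m₂
  expand : ∀ p Q → (p * Q + 1) * (Q * (Q * Q)) ≡ (p * (Q * Q) + 1 * Q) * (Q * Q)
  expand = solve-∀
  cross : ∀ p Q P → P ≡ p * Q + 1 → P * (Q * (Q * Q)) ≡ (p * (Q * Q) + 1 * Q) * (Q * Q)
  cross p Q _ refl = expand p Q
frac-+-unit minus p Q P gap = begin
  frac P Q²                                  ≡⟨ x+z≡y⇒x≡y-z sum≡ ⟩
  frac p (suc Q) - frac 1 Q²                 ≡⟨ cong (λ z → frac p (suc Q) - z) (ℚ.*-identityˡ (frac 1 Q²)) ⟨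
  frac p (suc Q) - 1ℚ ℚ.* frac 1 Q²          ≡⟨ cong (frac p (suc Q) ℚ.+_) (ℚ.neg-distribˡ-* 1ℚ (frac 1 Q²)) ⟩
  frac p (suc Q) ℚ.+ (ℚ.- 1ℚ) ℚ.* frac 1 Q²  ∎
  where
  open ≡-Reasoning
  m₂ : ℕ
  m₂ = Q + Q * suc Q
  Q² : ℕ
  Q² = suc m₂
  x+z≡y⇒x≡y-z : ∀ {x y z} → x ℚ.+ z ≡ y → x ≡ y - z
  x+z≡y⇒x≡y-z {x} {y} {z} e = begin
    x                ≡⟨ ℚ.+-identityʳ x ⟨
    x ℚ.+ 0ℚ         ≡⟨ cong (x ℚ.+_) (ℚ.+-inverseʳ z) ⟨
    x ℚ.+ (z - z)    ≡⟨ ℚ.+-assoc x z (ℚ.- z) ⟨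
    x ℚ.+ z - z      ≡⟨ cong (_- z) e ⟩
    y - z            ∎
  expand : ∀ P Q → (P * (Q * Q) + 1 * (Q * Q)) * Q ≡ (P + 1) * (Q * Q) * Q
  expand = solve-∀
  regroup : ∀ p Q → p * Q * (Q * Q) * Q ≡ p * ((Q * Q) * (Q * Q))
  regroup = solve-∀
  cross : ∀ p Q P → p * Q ≡ P + 1 → (P * (Q * Q) + 1 * (Q * Q)) * Q ≡ p * ((Q * Q) * (Q * Q))
  cross p Q P e = trans (expand P Q) (trans (cong (λ z → z * (Q * Q) * Q) (sym e)) (regroup p Q))
  sum≡ : frac P Q² ℚ.+ frac 1 Q² ≡ frac p (suc Q)
  sum≡ = trans (frac-+ P m₂ 1 m₂) (frac-cong (P * Q² + 1 * Q²) (m₂ + m₂ * suc m₂) p Q (cross p (suc Q) P gap))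

∣frac-frac∣ : ∀ X m X′ n →
  ∣ frac X (suc m) - frac X′ (suc n) ∣ ≡ frac ℤ.∣ X * suc n ℤ.⊖ X′ * suc m ∣ (suc m * suc n)
∣frac-frac∣ X m X′ n = ℚ.toℚᵘ-injective (ℚᵘ.≃-trans (ℚ.toℚᵘ-homo-∣-∣ (frac X (suc m) - frac X′ (suc n)))
  (ℚᵘ.≃-trans (ℚᵘ.∣-∣-cong (ℚᵘ.≃-trans difference (ℚᵘ.≃-reflexive (cong (λ z → mkℚᵘ z _) numerator))))
  (ℚᵘ.≃-sym (toℚᵘ-frac _ _))))
  where
  open ≡-Reasoning
  difference : toℚᵘ (frac X (suc m) - frac X′ (suc n)) ≃ᵘ
               mkℚᵘ (ℤ.+ X ℤ.* ℤ.+ suc n ℤ.+ ℤ.- (ℤ.+ X′) ℤ.* ℤ.+ suc m) (n + m * suc n)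
  difference = ℚᵘ.≃-trans (ℚ.toℚᵘ-homo-+ (frac X (suc m)) (ℚ.- frac X′ (suc n)))
    (ℚᵘ.+-cong (toℚᵘ-frac X m) (ℚᵘ.≃-trans (ℚ.toℚᵘ-homo‿- (frac X′ (suc n))) (ℚᵘ.-‿cong (toℚᵘ-frac X′ n))))
  numerator : ℤ.+ X ℤ.* ℤ.+ suc n ℤ.+ ℤ.- (ℤ.+ X′) ℤ.* ℤ.+ suc m ≡ X * suc n ℤ.⊖ X′ * suc m
  numerator = begin
    ℤ.+ X ℤ.* ℤ.+ suc n ℤ.+ ℤ.- (ℤ.+ X′) ℤ.* ℤ.+ suc m
      ≡⟨ cong₂ ℤ._+_ (ℤ.pos-* X (suc n)) (ℤ.neg-distribˡ-* (ℤ.+ X′) (ℤ.+ suc m)) ⟨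
    ℤ.+ (X * suc n) ℤ.+ ℤ.- (ℤ.+ X′ ℤ.* ℤ.+ suc m)       ≡⟨ cong (λ z → ℤ.+ (X * suc n) ℤ.+ ℤ.- z) (ℤ.pos-* X′ (suc m)) ⟨
    ℤ.+ (X * suc n) ℤ.+ ℤ.- ℤ.+ (X′ * suc m)             ≡⟨ ℤ.m-n≡m⊖n (X * suc n) (X′ * suc m) ⟩
    X * suc n ℤ.⊖ X′ * suc m                              ∎

frac<mkℚ : ∀ num d .(c : Coprime num (suc d)) E m → E * suc d < num * suc m → frac E (suc m) ℚ.< mkℚ (ℤ.+ num) d c
frac<mkℚ num d c E m h = ℚ.toℚᵘ-cancel-< (ℚᵘ.<-respˡ-≃ (ℚᵘ.≃-sym (toℚᵘ-frac E m))
  (ℚᵘ.*<* (subst₂ ℤ._<_ (ℤ.pos-* E (suc d)) (ℤ.pos-* num (suc m)) (ℤ.+<+ h))))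

m+A≡n+B⇒m∸n≤B : ∀ {m n A B} → m + A ≡ n + B → m ∸ n ≤ B
m+A≡n+B⇒m∸n≤B {m} {n} {A} {B} e =
  ≤-trans (∸-monoˡ-≤ n (m≤m+n m A)) (≤-reflexive (trans (cong (_∸ n) e) (m+n∸m≡n n B)))

∣⊖∣≤ : ∀ {a b A B D} → a + A ≡ b + B → A ≤ D → B ≤ D → ℤ.∣ a ℤ.⊖ b ∣ ≤ D
∣⊖∣≤ {a} {b} e A≤D B≤D with ≤-total a b
... | inj₁ a≤b = ≤-trans (≤-reflexive (ℤ.∣⊖∣-≤ a≤b)) (≤-trans (m+A≡n+B⇒m∸n≤B (sym e)) A≤D)
... | inj₂ b≤a = ≤-trans (≤-reflexive (trans (ℤ.∣m⊖n∣≡∣n⊖m∣ a b) (ℤ.∣⊖∣-≤ b≤a)))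
                         (≤-trans (m+A≡n+B⇒m∸n≤B e) B≤D)

-- A and B witness X Y′ − X′ Y = B − A.
∣frac-frac∣<mkℚ : ∀ num d .(c : Coprime num (suc d)) X m X′ n {A B D} →
  X * suc n + A ≡ X′ * suc m + B → A ≤ D → B ≤ D → D * suc d < num * (suc m * suc n) →
  ∣ frac X (suc m) - frac X′ (suc n) ∣ ℚ.< mkℚ (ℤ.+ num) d c
∣frac-frac∣<mkℚ num d c X m X′ n e A≤D B≤D D<num =
  subst (ℚ._< mkℚ (ℤ.+ num) d c) (sym (∣frac-frac∣ X m X′ n))
    (frac<mkℚ num d c ℤ.∣ X * suc n ℤ.⊖ X′ * suc m ∣ (n + m * suc n) (≤-<-trans (*-monoˡ-≤ (suc d) (∣⊖∣≤ e A≤D B≤D)) D<num))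

-- Runs of alternating sequences

alternating : Sign → List ℕ → List Sign
alternating c [] = []
alternating c (r ∷ rs) = replicate r c ++ alternating (opposite c) rs

replicate-∷ʳ : ∀ {A : Set} n (c : A) → replicate n c ∷ʳ c ≡ c ∷ replicate n c
replicate-∷ʳ zero c = refl
replicate-∷ʳ (suc n) c = cong (c ∷_) (replicate-∷ʳ n c)

reverse-replicate : ∀ {A : Set} n (c : A) → reverse (replicate n c) ≡ replicate n c
reverse-replicate zero c = refl
reverse-replicate (suc n) c = begin
  reverse (c ∷ replicate n c)  ≡⟨ unfold-reverse c (replicate n c) ⟩
  reverse (replicate n c) ∷ʳ c ≡⟨ cong (_∷ʳ c) (reverse-replicate n c) ⟩
  replicate n c ∷ʳ c           ≡⟨ replicate-∷ʳ n c ⟩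
  c ∷ replicate n c            ∎
  where open ≡-Reasoning

All-reverse : ∀ {A : Set} {P : A → Set} {xs} → All P xs → All P (reverse xs)
All-reverse [] = []
All-reverse {xs = x ∷ xs} (px ∷ pxs) = subst (All _) (sym (unfold-reverse x xs)) (∷ʳ⁺ (All-reverse pxs) px)

runsFrom-replicate : ∀ c k j rest → runsFrom c k (replicate j c ++ rest) ≡ runsFrom c (k + j) rest
runsFrom-replicate c k zero rest = cong (λ m → runsFrom c m rest) (sym (+-identityʳ k))
runsFrom-replicate plus k (suc j) rest =
  trans (runsFrom-replicate plus (suc k) j rest) (cong (λ m → runsFrom plus m rest) (sym (+-suc k j)))
runsFrom-replicate minus k (suc j) rest =
  trans (runsFrom-replicate minus (suc k) j rest) (cong (λ m → runsFrom minus m rest) (sym (+-suc k j)))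

runsFrom-alternating : ∀ c k rs → All (1 ≤_) rs → runsFrom c k (alternating (opposite c) rs) ≡ k ∷ rs
runsFrom-alternating c k [] _ = refl
runsFrom-alternating plus k (suc r ∷ rs) (_ ∷ rs⁺) =
  cong (k ∷_) (trans (runsFrom-replicate minus 1 r _) (runsFrom-alternating minus (suc r) rs rs⁺))
runsFrom-alternating minus k (suc r ∷ rs) (_ ∷ rs⁺) =
  cong (k ∷_) (trans (runsFrom-replicate plus 1 r _) (runsFrom-alternating plus (suc r) rs rs⁺))

runs-alternating : ∀ c rs → All (1 ≤_) rs → runs (alternating c rs) ≡ rs
runs-alternating c [] _ = refl
runs-alternating c (suc r ∷ rs) (_ ∷ rs⁺) =
  trans (runsFrom-replicate c 1 r _) (runsFrom-alternating c (suc r) rs rs⁺)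

nth-++ˡ : ∀ {A : Set} (d : A) xs ys t → t < length xs → nth d (xs ++ ys) t ≡ nth d xs t
nth-++ˡ d (x ∷ xs) ys zero _ = refl
nth-++ˡ d (x ∷ xs) ys (suc t) (s≤s t<n) = nth-++ˡ d xs ys t t<n

nth-All : ∀ {A : Set} {P : A → Set} d xs t → t < length xs → All P xs → P (nth d xs t)
nth-All d (x ∷ xs) zero _ (px ∷ _) = px
nth-All d (x ∷ xs) (suc t) (s≤s t<n) (_ ∷ pxs) = nth-All d xs t t<n pxs

signAt : Sign → ℕ → Sign
signAt c zero = c
signAt c (suc k) = signAt (opposite c) k

signAt-suc≢ : ∀ c k → signAt c (suc k) ≢ signAt c k
signAt-suc≢ c k eq = opposite≢ (signAt c k) (trans (sym (signAt-opposite c k)) eq)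
  where
  signAt-opposite : ∀ c k → signAt (opposite c) k ≡ opposite (signAt c k)
  signAt-opposite c zero = refl
  signAt-opposite c (suc k) = signAt-opposite (opposite c) k
  opposite≢ : ∀ c → opposite c ≢ c
  opposite≢ plus ()
  opposite≢ minus ()

psum-ext : ∀ a b k → (∀ i → i < k → a i ≡ b i) → psum a k ≡ psum b k
psum-ext a b zero _ = refl
psum-ext a b (suc k) a≗b = cong₂ _+_ (psum-ext a b k (λ i i<k → a≗b i (<-trans i<k (n<1+n k)))) (a≗b k (n<1+n k))

nth-alternating : ∀ c rs k j → k < length rs → j < nth 0 rs k →
                  nth plus (alternating c rs) (psum (nth 0 rs) k + j) ≡ signAt c k
nth-alternating c (r ∷ rs) zero j _ j<r = nth-replicate-++ r _ j<r
  where
  nth-replicate-++ : ∀ r X {j} → j < r → nth plus (replicate r c ++ X) j ≡ c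
  nth-replicate-++ (suc r) X {zero} _ = refl
  nth-replicate-++ (suc r) X {suc j} (s≤s j<r) = nth-replicate-++ r X j<r
nth-alternating c (r ∷ rs) (suc k) j (s≤s k<n) j<rₖ = begin
  nth plus (replicate r c ++ rest) (psum (nth 0 (r ∷ rs)) (suc k) + j) ≡⟨ cong (λ i → nth plus (replicate r c ++ rest) (i + j)) (psum-shift k) ⟩
  nth plus (replicate r c ++ rest) (r + psum (nth 0 rs) k + j)         ≡⟨ cong (nth plus (replicate r c ++ rest)) (+-assoc r _ j) ⟩
  nth plus (replicate r c ++ rest) (r + (psum (nth 0 rs) k + j))       ≡⟨ nth-replicate-+ r ⟩
  nth plus rest (psum (nth 0 rs) k + j)                                ≡⟨ nth-alternating (opposite c) rs k j k<n j<rₖ ⟩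
  signAt c (suc k)                                                     ∎
  where
  open ≡-Reasoning
  rest : List Sign
  rest = alternating (opposite c) rs
  psum-shift : ∀ k → psum (nth 0 (r ∷ rs)) (suc k) ≡ r + psum (nth 0 rs) k
  psum-shift zero = +-comm 0 r
  psum-shift (suc k) = trans (cong (_+ nth 0 rs k) (psum-shift k)) (+-assoc r _ _)
  nth-replicate-+ : ∀ r {i} → nth plus (replicate r c ++ rest) (r + i) ≡ nth plus rest i
  nth-replicate-+ zero = refl
  nth-replicate-+ (suc r) = nth-replicate-+ r

-- Block decomposition of paperfolding sequences

-- A block (x , y) stands for x entries 1 followed by y entries −1.
Blocks : Set
Blocks = List (ℕ × ℕ)

flatten : Blocks → List ℕ
flatten [] = []
flatten ((x , y) ∷ ps) = x ∷ y ∷ flatten ps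

blockSigns : Blocks → List Sign
blockSigns ps = alternating plus (flatten ps)

mirror : Blocks → Blocks
mirror ps = reverse (map swap ps)

-- The degenerate blocks for [] make the sign and matrix identities below hold without side conditions.
bumpFirst : Blocks → Blocks
bumpFirst [] = (1 , 0) ∷ []
bumpFirst ((x , y) ∷ ps) = (suc x , y) ∷ ps

bumpLast : Blocks → Blocks
bumpLast [] = (0 , 1) ∷ []
bumpLast ((x , y) ∷ []) = (x , suc y) ∷ []
bumpLast (p ∷ q ∷ ps) = p ∷ bumpLast (q ∷ ps)

unfoldBlocks : Sign → Blocks → Blocks
unfoldBlocks plus ps = ps ++ bumpFirst (mirror ps)
unfoldBlocks minus ps = bumpLast ps ++ mirror ps

flatten-++ : ∀ ps qs → flatten (ps ++ qs) ≡ flatten ps ++ flatten qs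
flatten-++ [] qs = refl
flatten-++ ((x , y) ∷ ps) qs = cong (λ z → x ∷ y ∷ z) (flatten-++ ps qs)

flatten-mirror : ∀ ps → flatten (mirror ps) ≡ reverse (flatten ps)
flatten-mirror [] = refl
flatten-mirror ((x , y) ∷ ps) = begin
  flatten (mirror ((x , y) ∷ ps))           ≡⟨ cong flatten (unfold-reverse (y , x) (map swap ps)) ⟩
  flatten (mirror ps ++ [ (y , x) ])        ≡⟨ flatten-++ (mirror ps) _ ⟩
  flatten (mirror ps) ++ y ∷ x ∷ []         ≡⟨ cong (_++ y ∷ x ∷ []) (flatten-mirror ps) ⟩
  reverse (flatten ps) ++ y ∷ x ∷ []        ≡⟨ ++-assoc (reverse (flatten ps)) [ y ] [ x ] ⟨
  (reverse (flatten ps) ∷ʳ y) ∷ʳ x          ≡⟨ cong (_∷ʳ x) (unfold-reverse y (flatten ps)) ⟨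
  reverse (y ∷ flatten ps) ∷ʳ x             ≡⟨ unfold-reverse x (y ∷ flatten ps) ⟨
  reverse (x ∷ y ∷ flatten ps)              ∎
  where open ≡-Reasoning

blockSigns-++ : ∀ ps qs → blockSigns (ps ++ qs) ≡ blockSigns ps ++ blockSigns qs
blockSigns-++ [] qs = refl
blockSigns-++ ((x , y) ∷ ps) qs = begin
  replicate x plus ++ replicate y minus ++ blockSigns (ps ++ qs)
    ≡⟨ cong (λ z → replicate x plus ++ replicate y minus ++ z) (blockSigns-++ ps qs) ⟩
  replicate x plus ++ replicate y minus ++ blockSigns ps ++ blockSigns qs
    ≡⟨ cong (replicate x plus ++_) (++-assoc (replicate y minus) _ _) ⟨
  replicate x plus ++ (replicate y minus ++ blockSigns ps) ++ blockSigns qs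
    ≡⟨ ++-assoc (replicate x plus) _ _ ⟨
  (replicate x plus ++ replicate y minus ++ blockSigns ps) ++ blockSigns qs ∎
  where open ≡-Reasoning

negate-reverse-blockSigns : ∀ ps → map opposite (reverse (blockSigns ps)) ≡ blockSigns (mirror ps)
negate-reverse-blockSigns [] = refl
negate-reverse-blockSigns ((x , y) ∷ ps) = begin
  map opposite (reverse (replicate x plus ++ replicate y minus ++ blockSigns ps))
    ≡⟨ cong (map opposite) (reverse-++ (replicate x plus) _) ⟩
  map opposite (reverse (replicate y minus ++ blockSigns ps) ++ reverse (replicate x plus))
    ≡⟨ cong (λ z → map opposite (z ++ reverse (replicate x plus))) (reverse-++ (replicate y minus) _) ⟩
  map opposite ((reverse (blockSigns ps) ++ reverse (replicate y minus)) ++ reverse (replicate x plus))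
    ≡⟨ cong₂ (λ u v → map opposite ((reverse (blockSigns ps) ++ u) ++ v)) (reverse-replicate y minus) (reverse-replicate x plus) ⟩
  map opposite ((reverse (blockSigns ps) ++ replicate y minus) ++ replicate x plus)
    ≡⟨ cong (map opposite) (++-assoc (reverse (blockSigns ps)) _ _) ⟩
  map opposite (reverse (blockSigns ps) ++ replicate y minus ++ replicate x plus)
    ≡⟨ map-++ opposite (reverse (blockSigns ps)) _ ⟩
  map opposite (reverse (blockSigns ps)) ++ map opposite (replicate y minus ++ replicate x plus)
    ≡⟨ cong₂ _++_ (negate-reverse-blockSigns ps) (map-++ opposite (replicate y minus) _) ⟩
  blockSigns (mirror ps) ++ map opposite (replicate y minus) ++ map opposite (replicate x plus)
    ≡⟨ cong₂ (λ u v → blockSigns (mirror ps) ++ u ++ v) (map-replicate opposite y minus) (map-replicate opposite x plus) ⟩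
  blockSigns (mirror ps) ++ replicate y plus ++ replicate x minus
    ≡⟨ cong (λ z → blockSigns (mirror ps) ++ replicate y plus ++ z) (++-identityʳ (replicate x minus)) ⟨
  blockSigns (mirror ps) ++ blockSigns [ (y , x) ]
    ≡⟨ blockSigns-++ (mirror ps) _ ⟨
  blockSigns (mirror ps ++ [ (y , x) ])
    ≡⟨ cong blockSigns (unfold-reverse (y , x) (map swap ps)) ⟨
  blockSigns (mirror ((x , y) ∷ ps)) ∎
  where open ≡-Reasoning

blockSigns-bumpLast : ∀ ps → blockSigns ps ∷ʳ minus ≡ blockSigns (bumpLast ps)
blockSigns-bumpLast [] = refl
blockSigns-bumpLast ((x , y) ∷ []) = begin
  (replicate x plus ++ replicate y minus ++ []) ∷ʳ minus ≡⟨ ++-assoc (replicate x plus) _ _ ⟩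
  replicate x plus ++ (replicate y minus ++ []) ∷ʳ minus ≡⟨ cong (λ z → replicate x plus ++ z ∷ʳ minus) (++-identityʳ _) ⟩
  replicate x plus ++ replicate y minus ∷ʳ minus        ≡⟨ cong (replicate x plus ++_) (replicate-∷ʳ y minus) ⟩
  replicate x plus ++ replicate (suc y) minus           ≡⟨ cong (replicate x plus ++_) (++-identityʳ _) ⟨
  replicate x plus ++ replicate (suc y) minus ++ []     ∎
  where open ≡-Reasoning
blockSigns-bumpLast ((x , y) ∷ q ∷ ps) = begin
  (replicate x plus ++ replicate y minus ++ blockSigns (q ∷ ps)) ∷ʳ minus
    ≡⟨ ++-assoc (replicate x plus) _ _ ⟩
  replicate x plus ++ (replicate y minus ++ blockSigns (q ∷ ps)) ∷ʳ minus
    ≡⟨ cong (replicate x plus ++_) (++-assoc (replicate y minus) _ _) ⟩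
  replicate x plus ++ replicate y minus ++ blockSigns (q ∷ ps) ∷ʳ minus
    ≡⟨ cong (λ z → replicate x plus ++ replicate y minus ++ z) (blockSigns-bumpLast (q ∷ ps)) ⟩
  replicate x plus ++ replicate y minus ++ blockSigns (bumpLast (q ∷ ps)) ∎
  where open ≡-Reasoning

unfoldStep-blockSigns : ∀ s ps → unfoldStep (blockSigns ps) s ≡ blockSigns (unfoldBlocks s ps)
unfoldStep-blockSigns plus ps = begin
  blockSigns ps ++ plus ∷ map opposite (reverse (blockSigns ps))
    ≡⟨ cong (λ z → blockSigns ps ++ plus ∷ z) (negate-reverse-blockSigns ps) ⟩
  blockSigns ps ++ plus ∷ blockSigns (mirror ps)
    ≡⟨ cong (blockSigns ps ++_) (blockSigns-bumpFirst (mirror ps)) ⟩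
  blockSigns ps ++ blockSigns (bumpFirst (mirror ps))
    ≡⟨ blockSigns-++ ps _ ⟨
  blockSigns (ps ++ bumpFirst (mirror ps)) ∎
  where
  open ≡-Reasoning
  blockSigns-bumpFirst : ∀ qs → plus ∷ blockSigns qs ≡ blockSigns (bumpFirst qs)
  blockSigns-bumpFirst [] = refl
  blockSigns-bumpFirst (_ ∷ _) = refl
unfoldStep-blockSigns minus ps = begin
  blockSigns ps ++ minus ∷ map opposite (reverse (blockSigns ps))
    ≡⟨ cong (λ z → blockSigns ps ++ minus ∷ z) (negate-reverse-blockSigns ps) ⟩
  blockSigns ps ++ [ minus ] ++ blockSigns (mirror ps)
    ≡⟨ ++-assoc (blockSigns ps) _ _ ⟨
  (blockSigns ps ∷ʳ minus) ++ blockSigns (mirror ps)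
    ≡⟨ cong (_++ blockSigns (mirror ps)) (blockSigns-bumpLast ps) ⟩
  blockSigns (bumpLast ps) ++ blockSigns (mirror ps)
    ≡⟨ blockSigns-++ (bumpLast ps) _ ⟨
  blockSigns (bumpLast ps ++ mirror ps) ∎
  where open ≡-Reasoning

initialBlocks : Sign → Blocks
initialBlocks plus = (2 , 1) ∷ []
initialBlocks minus = (1 , 2) ∷ []

-- blocks ε k are the blocks of P_{1, ε₂, …, ε_{k+2}}.
blocks : (ℕ → Sign) → ℕ → Blocks
blocks ε zero = initialBlocks (ε 2)
blocks ε (suc k) = unfoldBlocks (ε (3 + k)) (blocks ε k)

range2-suc : ∀ n → range2 (2 + n) ≡ range2 (1 + n) ∷ʳ (2 + n)
range2-suc n = begin
  map (_+ 2) (upTo (suc n))      ≡⟨ cong (map (_+ 2)) (upTo-∷ʳ n) ⟨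
  map (_+ 2) (upTo n ∷ʳ n)       ≡⟨ map-++ (_+ 2) (upTo n) _ ⟩
  map (_+ 2) (upTo n) ∷ʳ (n + 2) ≡⟨ cong (map (_+ 2) (upTo n) ∷ʳ_) (+-comm n 2) ⟩
  map (_+ 2) (upTo n) ∷ʳ (2 + n) ∎
  where open ≡-Reasoning

finInstr-suc : ∀ ε n → finInstr ε (2 + n) ≡ finInstr ε (1 + n) ∷ʳ ε (2 + n)
finInstr-suc ε n = cong (plus ∷_) (trans (cong (map ε) (range2-suc n)) (map-++ ε (range2 (1 + n)) _))

unfold-∷ʳ : ∀ f a → unfold (f ∷ʳ a) ≡ unfoldStep (unfold f) a
unfold-∷ʳ f a = foldl-++ unfoldStep [] f [ a ]

unfold-finInstr : ∀ ε k → unfold (finInstr ε (2 + k)) ≡ blockSigns (blocks ε k)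
unfold-finInstr ε zero with ε 2
... | plus = refl
... | minus = refl
unfold-finInstr ε (suc k) = begin
  unfold (finInstr ε (3 + k))                          ≡⟨ cong unfold (finInstr-suc ε (suc k)) ⟩
  unfold (finInstr ε (2 + k) ∷ʳ ε (3 + k))             ≡⟨ unfold-∷ʳ (finInstr ε (2 + k)) (ε (3 + k)) ⟩
  unfoldStep (unfold (finInstr ε (2 + k))) (ε (3 + k)) ≡⟨ cong (λ P → unfoldStep P (ε (3 + k))) (unfold-finInstr ε k) ⟩
  unfoldStep (blockSigns (blocks ε k)) (ε (3 + k))     ≡⟨ unfoldStep-blockSigns (ε (3 + k)) (blocks ε k) ⟩
  blockSigns (blocks ε (suc k))                        ∎
  where open ≡-Reasoning

length-mirror : ∀ ps → length (mirror ps) ≡ length ps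
length-mirror ps = trans (length-reverse (map swap ps)) (length-map swap ps)

length-unfoldBlocks : ∀ s ps → length ps + length ps ≤ length (unfoldBlocks s ps)
length-unfoldBlocks plus ps =
  ≤-trans (+-monoʳ-≤ (length ps) (≤-trans (≤-reflexive (sym (length-mirror ps))) (length-bumpFirst (mirror ps))))
          (≤-reflexive (sym (length-++ ps)))
  where
  length-bumpFirst : ∀ ps → length ps ≤ length (bumpFirst ps)
  length-bumpFirst [] = z≤n
  length-bumpFirst (_ ∷ _) = ≤-refl
length-unfoldBlocks minus ps =
  ≤-trans (+-mono-≤ (length-bumpLast ps) (≤-reflexive (sym (length-mirror ps))))
          (≤-reflexive (sym (length-++ (bumpLast ps))))
  where
  length-bumpLast : ∀ ps → length ps ≤ length (bumpLast ps)
  length-bumpLast [] = z≤n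
  length-bumpLast (_ ∷ []) = ≤-refl
  length-bumpLast (_ ∷ q ∷ ps) = s≤s (length-bumpLast (q ∷ ps))

blocks-length : ∀ ε k → suc k ≤ length (blocks ε k)
blocks-length ε zero with ε 2
... | plus = s≤s z≤n
... | minus = s≤s z≤n
blocks-length ε (suc k) =
  ≤-trans (s≤s (blocks-length ε k))
          (≤-trans (+-monoˡ-≤ (length (blocks ε k)) (≤-trans (s≤s z≤n) (blocks-length ε k)))
                   (length-unfoldBlocks (ε (3 + k)) (blocks ε k)))

Positive : Blocks → Set
Positive ps = All (1 ≤_) (flatten ps)

mirror-positive : ∀ ps → Positive ps → Positive (mirror ps)
mirror-positive ps ps⁺ = subst (All (1 ≤_)) (sym (flatten-mirror ps)) (All-reverse ps⁺)

unfoldBlocks-positive : ∀ s ps → 1 ≤ length ps → Positive ps → Positive (unfoldBlocks s ps)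
unfoldBlocks-positive plus ps ne ps⁺ = subst (All (1 ≤_)) (sym (flatten-++ ps _))
  (++⁺ ps⁺ (bumpFirst-positive (mirror ps) (≤-trans ne (≤-reflexive (sym (length-mirror ps)))) (mirror-positive ps ps⁺)))
  where
  bumpFirst-positive : ∀ ps → 1 ≤ length ps → Positive ps → Positive (bumpFirst ps)
  bumpFirst-positive ((x , y) ∷ ps) _ (_ ∷ y⁺ ∷ ps⁺) = s≤s z≤n ∷ y⁺ ∷ ps⁺
unfoldBlocks-positive minus ps ne ps⁺ = subst (All (1 ≤_)) (sym (flatten-++ (bumpLast ps) _))
  (++⁺ (bumpLast-positive ps ne ps⁺) (mirror-positive ps ps⁺))
  where
  bumpLast-positive : ∀ ps → 1 ≤ length ps → Positive ps → Positive (bumpLast ps)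
  bumpLast-positive ((x , y) ∷ []) _ (x⁺ ∷ _ ∷ []) = x⁺ ∷ s≤s z≤n ∷ []
  bumpLast-positive ((x , y) ∷ q ∷ ps) _ (x⁺ ∷ y⁺ ∷ ps⁺) = x⁺ ∷ y⁺ ∷ bumpLast-positive (q ∷ ps) (s≤s z≤n) ps⁺

blocks-positive : ∀ ε k → Positive (blocks ε k)
blocks-positive ε zero with ε 2
... | plus = s≤s z≤n ∷ s≤s z≤n ∷ []
... | minus = s≤s z≤n ∷ s≤s z≤n ∷ []
blocks-positive ε (suc k) =
  unfoldBlocks-positive (ε (3 + k)) (blocks ε k) (≤-trans (s≤s z≤n) (blocks-length ε k)) (blocks-positive ε k)

R-finInstr : ∀ ε k → R (finInstr ε (2 + k)) ≡ flatten (blocks ε k)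
R-finInstr ε k = trans (cong runs (unfold-finInstr ε k)) (runs-alternating plus _ (blocks-positive ε k))

-- The convergent invariant

blockMatrix : Blocks → M2
blockMatrix ps = cfMatrix (double (flatten ps))

pairMatrix : ℕ × ℕ → M2
pairMatrix (x , y) = mul (quotientMatrix (2 * x)) (quotientMatrix (2 * y))

blockMatrix-∷ : ∀ p ps → blockMatrix (p ∷ ps) ≡ mul (pairMatrix p) (blockMatrix ps)
blockMatrix-∷ (x , y) ps = sym (mul-assoc (quotientMatrix (2 * x)) (quotientMatrix (2 * y)) (blockMatrix ps))

blockMatrix-++ : ∀ ps qs → blockMatrix (ps ++ qs) ≡ mul (blockMatrix ps) (blockMatrix qs)
blockMatrix-++ ps qs = begin
  cfMatrix (double (flatten (ps ++ qs)))                   ≡⟨ cong (λ l → cfMatrix (double l)) (flatten-++ ps qs) ⟩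
  cfMatrix (double (flatten ps ++ flatten qs))              ≡⟨ cong cfMatrix (map-++ (2 *_) (flatten ps) (flatten qs)) ⟩
  cfMatrix (double (flatten ps) ++ double (flatten qs))     ≡⟨ cfMatrix-++ (double (flatten ps)) _ ⟩
  mul (blockMatrix ps) (blockMatrix qs)                    ∎
  where open ≡-Reasoning

blockMatrix-mirror : ∀ ps → blockMatrix (mirror ps) ≡ transpose (blockMatrix ps)
blockMatrix-mirror ps = begin
  cfMatrix (double (flatten (mirror ps)))   ≡⟨ cong (λ l → cfMatrix (double l)) (flatten-mirror ps) ⟩
  cfMatrix (double (reverse (flatten ps)))  ≡⟨ cong cfMatrix (reverse-map (2 *_) (flatten ps)) ⟩
  cfMatrix (reverse (double (flatten ps)))  ≡⟨ cfMatrix-reverse (double (flatten ps)) ⟩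
  transpose (blockMatrix ps)                ∎
  where open ≡-Reasoning

unfoldMatrix : Sign → M2
unfoldMatrix plus = m2 1 2 0 1
unfoldMatrix minus = m2 1 0 2 1

quotientMatrix-2+ : ∀ x → quotientMatrix (2 + x) ≡ mul (unfoldMatrix plus) (quotientMatrix x)
                        × quotientMatrix (2 + x) ≡ mul (quotientMatrix x) (unfoldMatrix minus)
quotientMatrix-2+ x = m2-cong (left x) refl refl refl , m2-cong (right x) (unit x) refl refl
  where
  unit : ∀ x → 1 ≡ x * 0 + 1 * 1
  unit = solve-∀
  left : ∀ x → 2 + x ≡ 1 * x + 2 * 1
  left = solve-∀
  right : ∀ x → 2 + x ≡ x * 1 + 1 * 2
  right = solve-∀

blockMatrix-bumpFirst : ∀ ps → blockMatrix (bumpFirst ps) ≡ mul (unfoldMatrix plus) (blockMatrix ps)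
blockMatrix-bumpFirst [] = refl
blockMatrix-bumpFirst ((x , y) ∷ ps) = begin
  mul (quotientMatrix (2 * suc x)) B                        ≡⟨ cong (λ z → mul (quotientMatrix z) B) (*-suc 2 x) ⟩
  mul (quotientMatrix (2 + 2 * x)) B                        ≡⟨ cong (λ M → mul M B) (proj₁ (quotientMatrix-2+ (2 * x))) ⟩
  mul (mul (unfoldMatrix plus) (quotientMatrix (2 * x))) B  ≡⟨ mul-assoc (unfoldMatrix plus) (quotientMatrix (2 * x)) B ⟩
  mul (unfoldMatrix plus) (blockMatrix ((x , y) ∷ ps))      ∎
  where
  open ≡-Reasoning
  B : M2
  B = cfMatrix (double (y ∷ flatten ps))

blockMatrix-bumpLast : ∀ ps → blockMatrix (bumpLast ps) ≡ mul (blockMatrix ps) (unfoldMatrix minus)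
blockMatrix-bumpLast [] = refl
blockMatrix-bumpLast ((x , y) ∷ []) = begin
  blockMatrix ((x , suc y) ∷ [])                        ≡⟨ blockMatrix-∷ (x , suc y) [] ⟩
  mul (pairMatrix (x , suc y)) I₂                       ≡⟨ mul-identityʳ (pairMatrix (x , suc y)) ⟩
  pairMatrix (x , suc y)                                ≡⟨ cong (mul X) (cong quotientMatrix (*-suc 2 y)) ⟩
  mul X (quotientMatrix (2 + 2 * y))                    ≡⟨ cong (mul X) (proj₂ (quotientMatrix-2+ (2 * y))) ⟩
  mul X (mul (quotientMatrix (2 * y)) (unfoldMatrix minus)) ≡⟨ mul-assoc X (quotientMatrix (2 * y)) (unfoldMatrix minus) ⟨
  mul (pairMatrix (x , y)) (unfoldMatrix minus)         ≡⟨ cong (λ M → mul M (unfoldMatrix minus)) (mul-identityʳ (pairMatrix (x , y))) ⟨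
  mul (mul (pairMatrix (x , y)) I₂) (unfoldMatrix minus) ≡⟨ cong (λ M → mul M (unfoldMatrix minus)) (blockMatrix-∷ (x , y) []) ⟨
  mul (blockMatrix ((x , y) ∷ [])) (unfoldMatrix minus)  ∎
  where
  open ≡-Reasoning
  X : M2
  X = quotientMatrix (2 * x)
blockMatrix-bumpLast (p ∷ q ∷ ps) = begin
  blockMatrix (p ∷ bumpLast (q ∷ ps))                        ≡⟨ blockMatrix-∷ p (bumpLast (q ∷ ps)) ⟩
  mul (pairMatrix p) (blockMatrix (bumpLast (q ∷ ps)))        ≡⟨ cong (mul (pairMatrix p)) (blockMatrix-bumpLast (q ∷ ps)) ⟩
  mul (pairMatrix p) (mul (blockMatrix (q ∷ ps)) (unfoldMatrix minus)) ≡⟨ mul-assoc (pairMatrix p) (blockMatrix (q ∷ ps)) (unfoldMatrix minus) ⟨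
  mul (mul (pairMatrix p) (blockMatrix (q ∷ ps))) (unfoldMatrix minus) ≡⟨ cong (λ M → mul M (unfoldMatrix minus)) (blockMatrix-∷ p (q ∷ ps)) ⟨
  mul (blockMatrix (p ∷ q ∷ ps)) (unfoldMatrix minus)        ∎
  where open ≡-Reasoning

sandwich : M2 → M2 → M2
sandwich E T = mul (mul T E) (transpose T)

blockMatrix-unfoldBlocks : ∀ s ps → blockMatrix (unfoldBlocks s ps) ≡ sandwich (unfoldMatrix s) (blockMatrix ps)
blockMatrix-unfoldBlocks plus ps = begin
  blockMatrix (ps ++ bumpFirst (mirror ps))                         ≡⟨ blockMatrix-++ ps _ ⟩
  mul T (blockMatrix (bumpFirst (mirror ps)))                       ≡⟨ cong (mul T) (blockMatrix-bumpFirst (mirror ps)) ⟩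
  mul T (mul (unfoldMatrix plus) (blockMatrix (mirror ps)))         ≡⟨ mul-assoc T _ _ ⟨
  mul (mul T (unfoldMatrix plus)) (blockMatrix (mirror ps))         ≡⟨ cong (mul (mul T (unfoldMatrix plus))) (blockMatrix-mirror ps) ⟩
  sandwich (unfoldMatrix plus) T                                    ∎
  where
  open ≡-Reasoning
  T : M2
  T = blockMatrix ps
blockMatrix-unfoldBlocks minus ps = begin
  blockMatrix (bumpLast ps ++ mirror ps)                        ≡⟨ blockMatrix-++ (bumpLast ps) _ ⟩
  mul (blockMatrix (bumpLast ps)) (blockMatrix (mirror ps))     ≡⟨ cong₂ mul (blockMatrix-bumpLast ps) (blockMatrix-mirror ps) ⟩
  sandwich (unfoldMatrix minus) (blockMatrix ps)                ∎
  where open ≡-Reasoning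

-- For T = cfMatrix l = [[p, p′], [q, q′]], [0, 1, l′] = (p + p′) / (p + p′ + q + q′).
approxNum approxDen : M2 → ℕ
approxNum (m2 a b c d) = a + b
approxDen (m2 a b c d) = a + b + c + d

sandwich-approxDen : ∀ a b c d e f g h →
  approxDen (sandwich (m2 e f g h) (m2 a b c d)) ≡ (a + c) * (a + c) * e + (a + c) * (b + d) * (f + g) + (b + d) * (b + d) * h
sandwich-approxDen = expand
  where
  expand : ∀ a b c d e f g h →
    (a * e + b * g) * a + (a * f + b * h) * b + ((a * e + b * g) * c + (a * f + b * h) * d)
      + ((c * e + d * g) * a + (c * f + d * h) * b) + ((c * e + d * g) * c + (c * f + d * h) * d)
      ≡ (a + c) * (a + c) * e + (a + c) * (b + d) * (f + g) + (b + d) * (b + d) * h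
  expand = solve-∀

sandwich-approxNum : ∀ a b c d e f g h →
  approxNum (sandwich (m2 e f g h) (m2 a b c d)) ≡ (a * e + b * g) * (a + c) + (a * f + b * h) * (b + d)
sandwich-approxNum = expand
  where
  expand : ∀ a b c d e f g h →
    (a * e + b * g) * a + (a * f + b * h) * b + ((a * e + b * g) * c + (a * f + b * h) * d)
      ≡ (a * e + b * g) * (a + c) + (a * f + b * h) * (b + d)
  expand = solve-∀

sandwich-step : ∀ s T → HasDet plus T →
  let T′ = sandwich (unfoldMatrix s) T in
  HasDet plus T′ × approxDen T′ ≡ approxDen T * approxDen T × UnitGap s (approxNum T′) (approxNum T * approxDen T)
sandwich-step s (m2 a b c d) det =
  HasDet-mul {plus} {plus} (mul T E) (transpose T)
    (HasDet-mul {plus} {plus} T E det (det-unfoldMatrix s)) (HasDet-transpose plus T det) ,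
  denominator s ,
  numerator s
  where
  T : M2
  T = m2 a b c d
  E : M2
  E = unfoldMatrix s
  det-unfoldMatrix : ∀ s → HasDet plus (unfoldMatrix s)
  det-unfoldMatrix plus = refl
  det-unfoldMatrix minus = refl
  square : ∀ a b c d → (a + c) * (a + c) * 1 + (a + c) * (b + d) * 2 + (b + d) * (b + d) * 1 ≡ (a + b + c + d) * (a + b + c + d)
  square = solve-∀
  denominator : ∀ s → approxDen (sandwich (unfoldMatrix s) T) ≡ approxDen T * approxDen T
  denominator plus = trans (sandwich-approxDen a b c d 1 2 0 1) (square a b c d)
  denominator minus = trans (sandwich-approxDen a b c d 1 0 2 1) (square a b c d)
  numerator : ∀ s → UnitGap s (approxNum (sandwich (unfoldMatrix s) T)) (approxNum T * approxDen T)
  numerator plus = UnitGap-shift plus (trans (cong (_+ b * c) (sandwich-approxNum a b c d 1 2 0 1)) (expand a b c d)) det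
    where
    expand : ∀ a b c d → (a * 1 + b * 0) * (a + c) + (a * 2 + b * 1) * (b + d) + b * c ≡ (a + b) * (a + b + c + d) + a * d
    expand = solve-∀
  numerator minus = UnitGap-shift minus (trans (cong (_+ a * d) (sandwich-approxNum a b c d 1 0 2 1)) (expand a b c d)) det
    where
    expand : ∀ a b c d → (a * 1 + b * 2) * (a + c) + (a * 0 + b * 1) * (b + d) + a * d ≡ (a + b) * (a + b + c + d) + b * c
    expand = solve-∀

Approximates : M2 → ℕ → ℚ → Set
Approximates T e A = HasDet plus T × approxDen T ≡ 2 ^ e × A ≡ frac (approxNum T) (approxDen T)

sandwich-approximates : ∀ s T e A → Approximates T e A →
  Approximates (sandwich (unfoldMatrix s) T) (2 * e) (A ℚ.+ signℚ s ℚ.* pow2inv (2 * e))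
sandwich-approximates s T e A (det , den , A≡p/q) with 2^n≡1+ e | sandwich-step s T det
... | Q , 2^e≡1+Q | det′ , den′ , gap = det′ , trans den′ den² , (begin
  A ℚ.+ signℚ s ℚ.* pow2inv (2 * e)                               ≡⟨ cong₂ (λ u v → u ℚ.+ signℚ s ℚ.* v) A≡p/Q pow2inv≡1/Q² ⟩
  frac (approxNum T) (suc Q) ℚ.+ signℚ s ℚ.* frac 1 (suc Q * suc Q) ≡⟨ frac-+-unit s (approxNum T) Q (approxNum T′) gap′ ⟨
  frac (approxNum T′) (suc Q * suc Q)                             ≡⟨ cong (frac (approxNum T′)) (trans den′ (cong₂ _*_ den≡1+Q den≡1+Q)) ⟨
  frac (approxNum T′) (approxDen T′)                              ∎)
  where
  open ≡-Reasoning
  T′ : M2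
  T′ = sandwich (unfoldMatrix s) T
  den≡1+Q : approxDen T ≡ suc Q
  den≡1+Q = trans den 2^e≡1+Q
  gap′ : UnitGap s (approxNum T′) (approxNum T * suc Q)
  gap′ = subst (λ q → UnitGap s (approxNum T′) (approxNum T * q)) den≡1+Q gap
  2^2e≡2^e*2^e : 2 ^ (2 * e) ≡ 2 ^ e * 2 ^ e
  2^2e≡2^e*2^e = trans (cong (2 ^_) (cong (e +_) (+-identityʳ e))) (^-distribˡ-+-* 2 e e)
  den² : approxDen T * approxDen T ≡ 2 ^ (2 * e)
  den² = trans (cong₂ _*_ den den) (sym 2^2e≡2^e*2^e)
  A≡p/Q : A ≡ frac (approxNum T) (suc Q)
  A≡p/Q = trans A≡p/q (cong (frac (approxNum T)) den≡1+Q)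
  pow2inv≡1/Q² : pow2inv (2 * e) ≡ frac 1 (suc Q * suc Q)
  pow2inv≡1/Q² = trans (pow2inv≡frac (2 * e)) (cong (frac 1) (trans 2^2e≡2^e*2^e (cong₂ _*_ 2^e≡1+Q 2^e≡1+Q)))

α-suc : ∀ ε k → α ε (3 + k) ≡ α ε (2 + k) ℚ.+ signℚ (ε (3 + k)) ℚ.* pow2inv (2 ^ (3 + k))
α-suc ε k = begin
  ½ ℚ.+ ¼ ℚ.+ sum (map term (range2 (3 + k)))                ≡⟨ cong (λ is → ½ ℚ.+ ¼ ℚ.+ sum (map term is)) (range2-suc (suc k)) ⟩
  ½ ℚ.+ ¼ ℚ.+ sum (map term (range2 (2 + k) ∷ʳ (3 + k)))     ≡⟨ cong (λ ts → ½ ℚ.+ ¼ ℚ.+ sum ts) (map-++ term (range2 (2 + k)) _) ⟩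
  ½ ℚ.+ ¼ ℚ.+ sum (map term (range2 (2 + k)) ∷ʳ term (3 + k))
    ≡⟨ cong (½ ℚ.+ ¼ ℚ.+_) (sum-∷ʳ (map term (range2 (2 + k))) (term (3 + k))) ⟩
  ½ ℚ.+ ¼ ℚ.+ (sum (map term (range2 (2 + k))) ℚ.+ term (3 + k)) ≡⟨ ℚ.+-assoc (½ ℚ.+ ¼) (sum (map term (range2 (2 + k)))) (term (3 + k)) ⟨
  α ε (2 + k) ℚ.+ term (3 + k)                             ∎
  where
  open ≡-Reasoning
  ¼ : ℚ
  ¼ = ℤ.+ 1 ℚ./ 4
  sum : List ℚ → ℚ
  sum = foldr ℚ._+_ 0ℚ
  term : ℕ → ℚ
  term i = signℚ (ε i) ℚ.* pow2inv (2 ^ i)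
  sum-∷ʳ : ∀ xs y → sum (xs ∷ʳ y) ≡ sum xs ℚ.+ y
  sum-∷ʳ [] y = trans (ℚ.+-identityʳ y) (sym (ℚ.+-identityˡ y))
  sum-∷ʳ (x ∷ xs) y = trans (cong (x ℚ.+_) (sum-∷ʳ xs y)) (sym (ℚ.+-assoc x (sum xs) y))

blocks-approximate : ∀ ε k → Approximates (blockMatrix (blocks ε k)) (2 ^ (2 + k)) (α ε (2 + k))
blocks-approximate ε zero with ε 2
... | plus = refl , refl , refl
... | minus = refl , refl , refl
blocks-approximate ε (suc k) =
  subst₂ (λ T A → Approximates T (2 ^ (3 + k)) A)
    (sym (blockMatrix-unfoldBlocks (ε (3 + k)) (blocks ε k))) (sym (α-suc ε k))
    (sandwich-approximates (ε (3 + k)) (blockMatrix (blocks ε k)) (2 ^ (2 + k)) (α ε (2 + k)) (blocks-approximate ε k))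

cfValue-approximant : ∀ x xs → cfValue (0 ∷ 1 ∷ incLast (x ∷ xs)) ≡ frac (approxNum (cfMatrix (x ∷ xs))) (approxDen (cfMatrix (x ∷ xs)))
cfValue-approximant x xs = begin
  cfValue (0 ∷ 1 ∷ incLast (x ∷ xs))                      ≡⟨ cfValue-0∷1∷ (incLast (x ∷ xs)) ⟩
  frac (ma (cfMatrix (incLast (x ∷ xs)))) (ma (cfMatrix (incLast (x ∷ xs))) + mc (cfMatrix (incLast (x ∷ xs))))
                                                          ≡⟨ cong (λ M → frac (ma M) (ma M + mc M)) (cfMatrix-incLast x xs) ⟩
  frac (ma (mul T (m2 1 0 1 1))) (ma (mul T (m2 1 0 1 1)) + mc (mul T (m2 1 0 1 1)))
                                                          ≡⟨ entries T ⟩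
  frac (approxNum T) (approxDen T)                        ∎
  where
  open ≡-Reasoning
  T : M2
  T = cfMatrix (x ∷ xs)
  row : ∀ u v → u * 1 + v * 1 ≡ u + v
  row u v = cong₂ _+_ (*-identityʳ u) (*-identityʳ v)
  entries : ∀ T → frac (ma (mul T (m2 1 0 1 1))) (ma (mul T (m2 1 0 1 1)) + mc (mul T (m2 1 0 1 1)))
                  ≡ frac (approxNum T) (approxDen T)
  entries (m2 a b c d) = cong₂ frac (row a b) (trans (cong₂ _+_ (row a b) (row c d)) (sym (+-assoc (a + b) c d)))

cfValue-blocks : ∀ ps {e A} → 1 ≤ length ps → Approximates (blockMatrix ps) e A →
                 cfValue (0 ∷ 1 ∷ incLast (double (flatten ps))) ≡ A
cfValue-blocks ((x , y) ∷ ps) _ (_ , _ , A≡p/q) =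
  trans (cfValue-approximant (2 * x) (2 * y ∷ double (flatten ps))) (sym A≡p/q)

finite-expansion : ∀ n → 2 ≤ n → ∀ ε → cfValue (0 ∷ 1 ∷ incLast (double (R (finInstr ε n)))) ≡ α ε n
finite-expansion (suc (suc k)) (s≤s (s≤s _)) ε rewrite R-finInstr ε k =
  cfValue-blocks (blocks ε k) {2 ^ (2 + k)} (≤-trans (s≤s z≤n) (blocks-length ε k)) (blocks-approximate ε k)

-- The run-length sequence of P_f

runLengths : (ℕ → Sign) → ℕ → List ℕ
runLengths ε k = flatten (blocks ε k)

length-flatten : ∀ ps → length (flatten ps) ≡ length ps + length ps
length-flatten [] = refl
length-flatten ((x , y) ∷ ps) = cong suc (trans (cong suc (length-flatten ps)) (sym (+-suc (length ps) (length ps))))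

runLengths-length : ∀ ε k → k + 2 ≤ length (runLengths ε k)
runLengths-length ε k = begin
  k + 2                                   ≡⟨ +-comm k 2 ⟩
  suc (suc k)                             ≤⟨ s≤s (blocks-length ε k) ⟩
  1 + length (blocks ε k)                 ≤⟨ +-monoˡ-≤ (length (blocks ε k)) (≤-trans (s≤s z≤n) (blocks-length ε k)) ⟩
  length (blocks ε k) + length (blocks ε k) ≡⟨ length-flatten (blocks ε k) ⟨
  length (runLengths ε k)                 ∎
  where open ≤-Reasoning

runLengths-long : ∀ ε {c M} → c ≤ M → suc c < length (runLengths ε M)
runLengths-long ε {M = M} c≤M = ≤-trans (s≤s (s≤s c≤M)) (≤-trans (≤-reflexive (+-comm 2 M)) (runLengths-length ε M))

runLengths-length-suc : ∀ ε k → length (runLengths ε k) ≤ length (runLengths ε (suc k))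
runLengths-length-suc ε k =
  subst₂ _≤_ (sym (length-flatten ps)) (sym (length-flatten (unfoldBlocks s ps))) (+-mono-≤ grows grows)
  where
  ps : Blocks
  ps = blocks ε k
  s : Sign
  s = ε (3 + k)
  grows : length ps ≤ length (unfoldBlocks s ps)
  grows = ≤-trans (m≤m+n _ _) (length-unfoldBlocks s ps)

-- Unfolding with ε changes only the last run: it is the one bumpLast extends.
nth-runLengths-suc : ∀ ε k t → suc t < length (runLengths ε k) → nth 0 (runLengths ε (suc k)) t ≡ nth 0 (runLengths ε k) t
nth-runLengths-suc ε k t t<n = nth-unfoldBlocks (ε (3 + k)) (blocks ε k) t<n
  where
  nth-bumpLast-++ : ∀ ps Z {t} → suc t < length (flatten ps) → nth 0 (flatten (bumpLast ps) ++ Z) t ≡ nth 0 (flatten ps) t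
  nth-bumpLast-++ ((x , y) ∷ []) Z {zero} _ = refl
  nth-bumpLast-++ ((x , y) ∷ []) Z {suc t} (s≤s (s≤s ()))
  nth-bumpLast-++ ((x , y) ∷ q ∷ ps) Z {zero} _ = refl
  nth-bumpLast-++ ((x , y) ∷ q ∷ ps) Z {suc zero} _ = refl
  nth-bumpLast-++ ((x , y) ∷ q ∷ ps) Z {suc (suc t)} (s≤s (s≤s t<n)) = nth-bumpLast-++ (q ∷ ps) Z t<n
  nth-unfoldBlocks : ∀ s ps {t} → suc t < length (flatten ps) → nth 0 (flatten (unfoldBlocks s ps)) t ≡ nth 0 (flatten ps) t
  nth-unfoldBlocks plus ps {t} t<n =
    trans (cong (λ l → nth 0 l t) (flatten-++ ps _)) (nth-++ˡ 0 (flatten ps) _ t (<-trans (n<1+n t) t<n))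
  nth-unfoldBlocks minus ps {t} t<n =
    trans (cong (λ l → nth 0 l t) (flatten-++ (bumpLast ps) _)) (nth-bumpLast-++ ps _ t<n)

runLengths-stable : ∀ ε k m t → k ≤ m → suc t < length (runLengths ε k) → nth 0 (runLengths ε m) t ≡ nth 0 (runLengths ε k) t
runLengths-stable ε k m t k≤m t<n = subst (λ m → nth 0 (runLengths ε m) t ≡ nth 0 (runLengths ε k) t) (m∸n+n≡m k≤m) (stable (m ∸ k))
  where
  grows : ∀ l → length (runLengths ε k) ≤ length (runLengths ε (l + k))
  grows zero = ≤-refl
  grows (suc l) = ≤-trans (grows l) (runLengths-length-suc ε (l + k))
  stable : ∀ l → nth 0 (runLengths ε (l + k)) t ≡ nth 0 (runLengths ε k) t
  stable zero = refl
  stable (suc l) = trans (nth-runLengths-suc ε (l + k) t (≤-trans t<n (grows l))) (stable l)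

-- The k-th entry has settled once k + 2 entries exist.
runSequence : (ℕ → Sign) → ℕ → ℕ
runSequence ε k = nth 0 (runLengths ε k) k

runSequence-agrees : ∀ ε k m → k ≤ m → nth 0 (runLengths ε m) k ≡ runSequence ε k
runSequence-agrees ε k m k≤m = runLengths-stable ε k m k k≤m (runLengths-long ε ≤-refl)

runSequence-positive : ∀ ε k → 1 ≤ runSequence ε k
runSequence-positive ε k =
  nth-All 0 (runLengths ε k) k (≤-trans (n≤1+n _) (runLengths-long ε ≤-refl)) (blocks-positive ε k)

length-prefix : ∀ {A : Set} (s : ℕ → A) n → length (prefix s n) ≡ n
length-prefix s zero = refl
length-prefix s (suc n) = trans (length-++ (prefix s n)) (trans (cong (_+ 1) (length-prefix s n)) (+-comm n 1))

prefix-extends : ∀ {A : Set} (s : ℕ → A) {m n} → m ≤ n → ∃ λ Q → prefix s n ≡ prefix s m ++ Q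
prefix-extends s {n = zero} z≤n = [] , refl
prefix-extends s {m} {suc n} m≤1+n with m≤n⇒m<n∨m≡n m≤1+n
... | inj₂ refl = [] , sym (++-identityʳ _)
... | inj₁ (s≤s m≤n) with prefix-extends s m≤n
...   | Q , eq = Q ∷ʳ s n , trans (cong (_∷ʳ s n) eq) (++-assoc (prefix s m) Q _)

unfold-extends : ∀ f g → ∃ λ Q → unfold (f ++ g) ≡ unfold f ++ Q
unfold-extends f g = trans′ (foldl-extends (unfold f) g) (foldl-++ unfoldStep [] f g)
  where
  trans′ : ∀ {P X : List Sign} → (∃ λ Q → X ≡ P ++ Q) → ∀ {Y} → Y ≡ X → ∃ λ Q → Y ≡ P ++ Q
  trans′ (Q , eq) e = Q , trans e eq
  foldl-extends : ∀ P g → ∃ λ Q → foldl unfoldStep P g ≡ P ++ Q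
  foldl-extends P [] = [] , sym (++-identityʳ P)
  foldl-extends P (a ∷ g) with foldl-extends (unfoldStep P a) g
  ... | Q , eq = _ , trans eq (++-assoc P _ Q)

length-unfold : ∀ f → length f ≤ length (unfold f)
length-unfold f = foldl-grows [] f
  where
  foldl-grows : ∀ P g → length P + length g ≤ length (foldl unfoldStep P g)
  foldl-grows P [] = ≤-reflexive (+-identityʳ (length P))
  foldl-grows P (a ∷ g) = ≤-trans (≤-reflexive (+-suc (length P) (length g)))
    (≤-trans (+-monoˡ-≤ (length g) (≤-trans (≤-reflexive (+-comm 1 (length P))) (+-monoʳ-≤ (length P) (s≤s z≤n))))
    (≤-trans (+-monoˡ-≤ (length g) (≤-reflexive (sym (length-++ P)))) (foldl-grows (unfoldStep P a) g)))

finInstr≡prefix : ∀ ε n → finInstr ε (suc n) ≡ prefix (infInstr ε) (suc n)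
finInstr≡prefix ε zero = refl
finInstr≡prefix ε (suc n) = trans (finInstr-suc ε n) (cong (_∷ʳ ε (2 + n)) (finInstr≡prefix ε n))

Pinf-runLengths : ∀ ε j k → j < 2 + k → Pinf (infInstr ε) j ≡ nth plus (alternating plus (runLengths ε k)) j
Pinf-runLengths ε j k j<2+k with prefix-extends (infInstr ε) j<2+k
... | Q , prefix-eq with unfold-extends (prefix (infInstr ε) (suc j)) Q
...   | Q′ , unfold-eq = begin
  nth plus Pⱼ j                                          ≡⟨ nth-++ˡ plus Pⱼ Q′ j j<length ⟨
  nth plus (Pⱼ ++ Q′) j                                  ≡⟨ cong (λ P → nth plus P j) (trans (sym unfold-eq) (cong unfold (sym prefix-eq))) ⟩
  nth plus (unfold (prefix (infInstr ε) (2 + k))) j      ≡⟨ cong (λ f → nth plus (unfold f) j) (finInstr≡prefix ε (suc k)) ⟨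
  nth plus (unfold (finInstr ε (2 + k))) j               ≡⟨ cong (λ P → nth plus P j) (unfold-finInstr ε k) ⟩
  nth plus (alternating plus (runLengths ε k)) j         ∎
  where
  open ≡-Reasoning
  Pⱼ : List Sign
  Pⱼ = unfold (prefix (infInstr ε) (suc j))
  j<length : j < length Pⱼ
  j<length = ≤-trans (≤-reflexive (sym (length-prefix (infInstr ε) (suc j)))) (length-unfold (prefix (infInstr ε) (suc j)))

Pinf-in-run : ∀ ε k j → j < runSequence ε k → Pinf (infInstr ε) (psum (runSequence ε) k + j) ≡ signAt plus k
Pinf-in-run ε k j j<aₖ = begin
  Pinf (infInstr ε) (psum a k + j)                       ≡⟨ Pinf-runLengths ε (psum a k + j) M (s≤s (≤-trans (m≤m+n _ k) (n≤1+n M))) ⟩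
  nth plus (alternating plus Rₘ) (psum a k + j)          ≡⟨ cong (λ i → nth plus (alternating plus Rₘ) (i + j)) (psum-ext a (nth 0 Rₘ) k a≗Rₘ) ⟩
  nth plus (alternating plus Rₘ) (psum (nth 0 Rₘ) k + j) ≡⟨ nth-alternating plus Rₘ k j k<length j<Rₘₖ ⟩
  signAt plus k                                          ∎
  where
  open ≡-Reasoning
  a : ℕ → ℕ
  a = runSequence ε
  M : ℕ
  M = psum a k + j + k
  Rₘ : List ℕ
  Rₘ = runLengths ε M
  k≤M : k ≤ M
  k≤M = m≤n+m k _
  a≗Rₘ : ∀ i → i < k → a i ≡ nth 0 Rₘ i
  a≗Rₘ i i<k = sym (runSequence-agrees ε i M (≤-trans (<⇒≤ i<k) k≤M))
  k<length : k < length Rₘ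
  k<length = ≤-trans (n≤1+n _) (runLengths-long ε k≤M)
  j<Rₘₖ : j < nth 0 Rₘ k
  j<Rₘₖ = subst (j <_) (sym (runSequence-agrees ε k M k≤M)) j<aₖ

runSequence-isRunLengths : ∀ ε → IsRunLengths (Pinf (infInstr ε)) (runSequence ε)
runSequence-isRunLengths ε = runSequence-positive ε , within-run , between-runs
  where
  a : ℕ → ℕ
  a = runSequence ε
  P : ℕ → Sign
  P = Pinf (infInstr ε)
  run-start : ∀ k → P (psum a k) ≡ signAt plus k
  run-start k = trans (cong P (sym (+-identityʳ (psum a k)))) (Pinf-in-run ε k 0 (runSequence-positive ε k))
  within-run : ∀ k j → j < a k → P (psum a k + j) ≡ P (psum a k)
  within-run k j j<aₖ = trans (Pinf-in-run ε k j j<aₖ) (sym (run-start k))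
  between-runs : ∀ k → P (psum a (suc k)) ≢ P (psum a k)
  between-runs k eq = signAt-suc≢ plus k (trans (sym (run-start (suc k))) (trans eq (run-start k)))

-- Convergence

cfMatrix-column : ∀ U → All (1 ≤_) U →
  mc (cfMatrix U) ≤ ma (cfMatrix U) × 1 ≤ ma (cfMatrix U) × length U + 1 ≤ ma (cfMatrix U) + mc (cfMatrix U)
cfMatrix-column [] [] = z≤n , s≤s z≤n , s≤s z≤n
cfMatrix-column (x ∷ U) (1≤x ∷ U⁺) with cfMatrix U | cfMatrix-column U U⁺
... | m2 p _ q _ | q≤p , 1≤p , growth =
  ≤-trans (≤-reflexive (entry p q)) (≤-trans p≤xp (m≤m+n (x * p) (1 * q))) ,
  ≤-trans 1≤p (≤-trans p≤xp (m≤m+n (x * p) (1 * q))) ,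
  ≤-trans (s≤s growth) (≤-trans (+-monoˡ-≤ (p + q) (≤-trans 1≤p p≤xp)) (≤-reflexive (regroup x p q)))
  where
  p≤xp : p ≤ x * p
  p≤xp = ≤-trans (≤-reflexive (sym (*-identityˡ p))) (*-monoˡ-≤ p 1≤x)
  entry : ∀ p q → 1 * p + 0 * q ≡ p
  entry = solve-∀
  regroup : ∀ x p q → x * p + (p + q) ≡ x * p + 1 * q + (1 * p + 0 * q)
  regroup = solve-∀

-- The two continuations differ by det M · (p q′ − p′ q), with det M = ±1.
continuation-cross : ∀ {σ} u v w z → HasDet σ (m2 u v w z) → ∀ {p q p′ q′} → q ≤ p → q′ ≤ p′ →
  ∃₂ λ A B → (u * p + v * q) * (w * p′ + z * q′) + A ≡ (u * p′ + v * q′) * (w * p + z * q) + B × A ≤ p * p′ × B ≤ p * p′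
continuation-cross {plus} u v w z det {p} {q} {p′} {q′} q≤p q′≤p′ =
  p′ * q , p * q′ , cross-cancel (expand u v w z p q p′ q′) det , p′q≤pp′ , *-monoʳ-≤ p q′≤p′
  where
  p′q≤pp′ : p′ * q ≤ p * p′
  p′q≤pp′ = ≤-trans (*-monoʳ-≤ p′ q≤p) (≤-reflexive (*-comm p′ p))
  expand : ∀ u v w z p q p′ q′ →
    (u * p + v * q) * (w * p′ + z * q′) + u * z * (p′ * q) + v * w * (p * q′) ≡
    (u * p′ + v * q′) * (w * p + z * q) + u * z * (p * q′) + v * w * (p′ * q)
  expand = solve-∀
continuation-cross {minus} u v w z det {p} {q} {p′} {q′} q≤p q′≤p′ =
  p * q′ , p′ * q , cross-cancel (expand u v w z p q p′ q′) det , *-monoʳ-≤ p q′≤p′ , p′q≤pp′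
  where
  p′q≤pp′ : p′ * q ≤ p * p′
  p′q≤pp′ = ≤-trans (*-monoʳ-≤ p′ q≤p) (≤-reflexive (*-comm p′ p))
  expand : ∀ u v w z p q p′ q′ →
    (u * p + v * q) * (w * p′ + z * q′) + v * w * (p * q′) + u * z * (p′ * q) ≡
    (u * p′ + v * q′) * (w * p + z * q) + v * w * (p′ * q) + u * z * (p * q′)
  expand = solve-∀

-- M is the matrix of a common prefix, U and V those of two positive tails.
convergents-close : ∀ num .{{_ : ℕ.NonZero num}} d .(c : Coprime num (suc d)) → ∀ {σ} M U V → HasDet σ M → 2 + d ≤ mc M →
  mc U ≤ ma U → 1 ≤ ma U → mc V ≤ ma V → 1 ≤ ma V →
  ∣ frac (ma (mul M U)) (mc (mul M U)) - frac (ma (mul M V)) (mc (mul M V)) ∣ ℚ.< mkℚ (ℤ.+ num) d c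
convergents-close num d c (m2 u v (suc w′) z) (m2 (suc p₀) _ q _) (m2 (suc p₀′) _ q′ _) det 2+d≤w q≤p _ q′≤p′ _
  with continuation-cross u v (suc w′) z det q≤p q′≤p′
... | A , B , cross , A≤pp′ , B≤pp′ =
  ∣frac-frac∣<mkℚ num d c (u * p + v * q) (p₀ + w′ * p + z * q) (u * p′ + v * q′) (p₀′ + w′ * p′ + z * q′)
    cross A≤pp′ B≤pp′ (begin-strict
  p * p′ * suc d      <⟨ m<n+m (p * p′ * suc d) (*-mono-≤ {1} {p} {1} {p′} (s≤s z≤n) (s≤s z≤n)) ⟩
  p * p′ + p * p′ * suc d ≡⟨ *-suc (p * p′) (suc d) ⟨
  p * p′ * (2 + d)    ≤⟨ *-monoʳ-≤ (p * p′) 2+d≤w ⟩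
  p * p′ * w          ≤⟨ *-monoʳ-≤ (p * p′) (m≤m*n w w) ⟩
  p * p′ * (w * w)    ≡⟨ regroup p p′ w ⟩
  (w * p) * (w * p′)  ≤⟨ *-mono-≤ (m≤m+n (w * p) (z * q)) (m≤m+n (w * p′) (z * q′)) ⟩
  Y * Y′              ≤⟨ m≤n*m (Y * Y′) num ⟩
  num * (Y * Y′)      ∎)
  where
  open ≤-Reasoning
  w : ℕ
  w = suc w′
  p : ℕ
  p = suc p₀
  p′ : ℕ
  p′ = suc p₀′
  Y : ℕ
  Y = w * p + z * q
  Y′ : ℕ
  Y′ = w * p′ + z * q′
  regroup : ∀ p p′ w → p * p′ * (w * w) ≡ (w * p) * (w * p′)
  regroup = solve-∀

cfValue-++-close : ∀ num .{{_ : ℕ.NonZero num}} d .(c : Coprime num (suc d)) C U V → All (1 ≤_) U → All (1 ≤_) V →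
  2 + d ≤ mc (cfMatrix C) → ∣ cfValue (C ++ U) - cfValue (C ++ V) ∣ ℚ.< mkℚ (ℤ.+ num) d c
cfValue-++-close num d c C U V U⁺ V⁺ 2+d≤q with cfMatrix-unimodular C | cfMatrix-column U U⁺ | cfMatrix-column V V⁺
... | _ , det | qᵤ≤pᵤ , 1≤pᵤ , _ | qᵥ≤pᵥ , 1≤pᵥ , _ =
  subst₂ (λ x y → ∣ x - y ∣ ℚ.< mkℚ (ℤ.+ num) d c) (sym (cfValue-++ C U)) (sym (cfValue-++ C V))
    (convergents-close num d c (cfMatrix C) (cfMatrix U) (cfMatrix V) det 2+d≤q qᵤ≤pᵤ 1≤pᵤ qᵥ≤pᵥ 1≤pᵥ)

cfMatrix-0∷1∷-denominator : ∀ D → All (1 ≤_) D → length D + 1 ≤ mc (cfMatrix (0 ∷ 1 ∷ D))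
cfMatrix-0∷1∷-denominator D D⁺ with cfMatrix D | cfMatrix-column D D⁺
... | m2 p _ q _ | _ , _ , growth = ≤-trans growth (≤-reflexive (expand p q))
  where
  expand : ∀ p q → p + q ≡ 1 * (1 * p + 1 * q) + 0 * (1 * p + 0 * q)
  expand = solve-∀

prefix-suc : ∀ {A : Set} (a : ℕ → A) n → prefix a (suc n) ≡ a 0 ∷ prefix (λ i → a (suc i)) n
prefix-suc a zero = refl
prefix-suc a (suc n) = cong (_∷ʳ a (suc n)) (prefix-suc a n)

prefix-split : ∀ (a : ℕ → ℕ) xs c → c < length xs → (∀ t → t < c → nth 0 xs t ≡ a t) →
               ∃₂ λ y ys → xs ≡ prefix a c ++ y ∷ ys
prefix-split a (x ∷ xs) zero _ _ = x , xs , refl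
prefix-split a (x ∷ xs) (suc c) (s≤s c<n) agree with prefix-split (λ i → a (suc i)) xs c c<n (λ t t<c → agree (suc t) (s≤s t<c))
... | y , ys , xs≡ = y , ys , trans (cong₂ _∷_ (agree 0 (s≤s z≤n)) xs≡) (cong (_++ y ∷ ys) (sym (prefix-suc a c)))

All-prefix : ∀ {P : ℕ → Set} a n → (∀ t → P (a t)) → All P (prefix a n)
All-prefix a zero _ = []
All-prefix a (suc n) Pa = ∷ʳ⁺ (All-prefix a n Pa) (Pa n)

All-double : ∀ {xs} → All (1 ≤_) xs → All (1 ≤_) (double xs)
All-double [] = []
All-double {x ∷ _} (1≤x ∷ xs⁺) = ≤-trans 1≤x (m≤m+n x (x + 0)) ∷ All-double xs⁺

All-incLast : ∀ {xs} → All (1 ≤_) xs → All (1 ≤_) (incLast xs)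
All-incLast [] = []
All-incLast (_ ∷ []) = s≤s z≤n ∷ []
All-incLast (1≤x ∷ 1≤y ∷ xs⁺) = 1≤x ∷ All-incLast (1≤y ∷ xs⁺)

incLast-++ : ∀ xs y ys → incLast (xs ++ y ∷ ys) ≡ xs ++ incLast (y ∷ ys)
incLast-++ [] y ys = refl
incLast-++ (x ∷ []) y ys = refl
incLast-++ (x ∷ x′ ∷ xs) y ys = cong (x ∷_) (incLast-++ (x′ ∷ xs) y ys)

prefix-cfSeq : ∀ a i → prefix (cfSeq a) (2 + i) ≡ 0 ∷ 1 ∷ double (prefix a i)
prefix-cfSeq a zero = refl
prefix-cfSeq a (suc i) =
  trans (cong (_∷ʳ 2 * a i) (prefix-cfSeq a i)) (cong (λ l → 0 ∷ 1 ∷ l) (sym (map-++ (2 *_) (prefix a i) [ a i ])))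

-- Both sides share the partial quotients 0, 1, 2a₀, …, 2a_d, so they differ by less than 1 / (d + 1).
approximation-close : ∀ ε num .{{_ : ℕ.NonZero num}} d .(c : Coprime num (suc d)) i M → suc d ≤ i → suc d ≤ M →
  ∣ cfValue (prefix (cfSeq (runSequence ε)) (2 + i)) - α ε (2 + M) ∣ ℚ.< mkℚ (ℤ.+ num) d c
approximation-close ε num d c i M d<i d<M
  with prefix-extends (runSequence ε) d<i
     | prefix-split (runSequence ε) (runLengths ε M) (suc d) (≤-trans (n≤1+n _) (runLengths-long ε d<M))
         (λ t t<1+d → runSequence-agrees ε t M (≤-trans (n≤1+n t) (≤-trans t<1+d d<M)))
... | Q , prefixᵢ≡ | y , ys , Rₘ≡ =
  subst₂ (λ x y → ∣ x - y ∣ ℚ.< mkℚ (ℤ.+ num) d c) (sym convergent≡) (sym α≡)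
    (cfValue-++-close num d c C (double Q) (incLast (double (y ∷ ys))) U⁺ V⁺ 2+d≤q)
  where
  open ≡-Reasoning
  a : ℕ → ℕ
  a = runSequence ε
  common : List ℕ
  common = double (prefix a (suc d))
  C : List ℕ
  C = 0 ∷ 1 ∷ common
  length-common : length common ≡ suc d
  length-common = trans (length-map (2 *_) (prefix a (suc d))) (length-prefix a (suc d))
  2+d≤q : 2 + d ≤ mc (cfMatrix C)
  2+d≤q = ≤-trans (≤-reflexive (trans (+-comm 1 (suc d)) (cong (_+ 1) (sym length-common))))
                  (cfMatrix-0∷1∷-denominator common (All-double (All-prefix a (suc d) (runSequence-positive ε))))
  U⁺ : All (1 ≤_) (double Q)
  U⁺ = All-double (++⁻ʳ (prefix a (suc d)) (subst (All (1 ≤_)) prefixᵢ≡ (All-prefix a i (runSequence-positive ε))))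
  V⁺ : All (1 ≤_) (incLast (double (y ∷ ys)))
  V⁺ = All-incLast (All-double (++⁻ʳ (prefix a (suc d)) (subst (All (1 ≤_)) Rₘ≡ (blocks-positive ε M))))
  convergent≡ : cfValue (prefix (cfSeq a) (2 + i)) ≡ cfValue (C ++ double Q)
  convergent≡ = cong cfValue (begin
    prefix (cfSeq a) (2 + i)                   ≡⟨ prefix-cfSeq a i ⟩
    0 ∷ 1 ∷ double (prefix a i)                ≡⟨ cong (λ l → 0 ∷ 1 ∷ double l) prefixᵢ≡ ⟩
    0 ∷ 1 ∷ double (prefix a (suc d) ++ Q)     ≡⟨ cong (λ l → 0 ∷ 1 ∷ l) (map-++ (2 *_) (prefix a (suc d)) Q) ⟩
    C ++ double Q                              ∎)
  α≡ : α ε (2 + M) ≡ cfValue (C ++ incLast (double (y ∷ ys)))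
  α≡ = begin
    α ε (2 + M)                                                   ≡⟨ finite-expansion (2 + M) (s≤s (s≤s z≤n)) ε ⟨
    cfValue (0 ∷ 1 ∷ incLast (double (R (finInstr ε (2 + M)))))
      ≡⟨ cong (λ l → cfValue (0 ∷ 1 ∷ incLast (double l))) (trans (R-finInstr ε M) Rₘ≡) ⟩
    cfValue (0 ∷ 1 ∷ incLast (double (prefix a (suc d) ++ y ∷ ys)))
      ≡⟨ cong (λ l → cfValue (0 ∷ 1 ∷ incLast l)) (map-++ (2 *_) (prefix a (suc d)) (y ∷ ys)) ⟩
    cfValue (0 ∷ 1 ∷ incLast (common ++ double (y ∷ ys)))
      ≡⟨ cong (λ l → cfValue (0 ∷ 1 ∷ l)) (incLast-++ common (2 * y) (double ys)) ⟩
    cfValue (C ++ incLast (double (y ∷ ys)))                      ∎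

convergence : ∀ ε (δ : ℚ) → 0ℚ ℚ.< δ → ∃ λ K → ∀ k N → K ≤ k → K ≤ N →
  ∣ cfValue (prefix (cfSeq (runSequence ε)) k) - α ε N ∣ ℚ.< δ
convergence ε (mkℚ (ℤ.+ suc n) d c) _ = 3 + d , close
  where
  close : ∀ k N → 3 + d ≤ k → 3 + d ≤ N → ∣ cfValue (prefix (cfSeq (runSequence ε)) k) - α ε N ∣ ℚ.< mkℚ (ℤ.+ suc n) d c
  close (suc (suc i)) (suc (suc M)) (s≤s (s≤s d<i)) (s≤s (s≤s d<M)) = approximation-close ε (suc n) d c i M d<i d<M
convergence ε (mkℚ (ℤ.+ zero) d c) (ℚ.*<* (ℤ.+<+ ()))
convergence ε (mkℚ ℤ.-[1+ n ] d c) (ℚ.*<* ())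

theorem11 :
    ((n : ℕ) → 2 ≤ n → (ε : ℕ → Sign) →
      cfValue (0 ∷ 1 ∷ incLast (double (R (finInstr ε n)))) ≡ α ε n)
    ×
    ((ε : ℕ → Sign) →
      ∃ λ (a : ℕ → ℕ) → IsRunLengths (Pinf (infInstr ε)) a ×
        ((δ : ℚ) → 0ℚ ℚ.< δ → ∃ λ (K : ℕ) → (k N : ℕ) → K ≤ k → K ≤ N →
          ∣ cfValue (prefix (cfSeq a) k) - α ε N ∣ ℚ.< δ))
theorem11 = finite-expansion , λ ε → runSequence ε , runSequence-isRunLengths ε , convergence ε
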